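{- Let $r\ge2$, $n\ge1$, let $\lambda_2\ge\lambda_3\ge\dots\ge\lambda_{r+1}$ be integers, $\nu=(\lambda_3,\dots,\lambda_{r+1})$, let $\Gamma_0=(\Gamma_{13},\dots,\Gamma_{1r})$ be $\nu$-admissible with $\Gamma_{1r}\ne0$ (when $r=2$, $\Gamma_0$ is empty and $\Gamma_{13}:=0$), and let $a$ be a positive integer divisible by $n$. Put $B=\Gamma_{13}+\lambda_2-\lambda_3+1$ and $$f_{a,\Gamma_0}(x_{r-1},x_r)=\sum_{c=1}^{B}\delta_a(c)\,h(c)\,x_{r-1}^{\lambda_3+c-\Gamma_{13}}\,x_r^{\lambda_2+a-c},$$ where $\delta_a(c)=1-v$ if $a<c$, $-v$ if $a=c$, $0$ if $a>c$, and $h(c)=h^\flat(c)$ if $c<B$, $h(c)=g^\flat(c)$ if $c=B$. Then $\mathcal{D}_{r-1}f_{a,\Gamma_0}=0$.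
   Context: $\nu$-admissible: with $\Gamma_{1,r+1}:=0$, $\Gamma_{1,j+1}\le\Gamma_{1j}\le\Gamma_{1,j+1}+\lambda_j-\lambda_{j+1}+1$ for $3\le j\le r$. Parameters: $v=q^{ -1}$, $g_j=\sum_{b\in(\mathfrak{o}_S/p)^\times}(b/p)_n^{\,j}\psi(b/p)$ (Gauss sums at a prime $p$ with residue field of size $q\equiv1\bmod2n$ of a ring of $S$-integers (PID) of a number field containing the $2n$-th roots of unity, $\psi$ additive of conductor $\mathfrak{o}_S$); $g_j$ depends on $j\bmod n$, $g_0=-1$, $g_jg_{n-j}=v^{ -1}$. $h^\flat(c)=1-v$ if $n\mid c$, else $0$; $g^\flat(c)=v\,g_c$. Chinta–Gunnells action on $\mathbb{C}(\mathbf{x})$, $\mathbf{x}=(x_1,\dots,x_{r+1})$, $\alpha_i=e_i-e_{i+1}$, $\mathbf{x}^{n\alpha_i}=(x_i/x_{i+1})^n$, $r_n(j)\in\{0,\dots,n-1\}$ the residue mod $n$: $\Lambda_0=\{\mu\in\mathbb{Z}^{r+1}:\mu_i\equiv\mu_j\bmod n\}$; $\mathbb{C}(\mathbf{x})=\bigoplus\mathcal{K}_{\bar\mu}$ (eigenspaces for $\mathbf{x}^\mu\mapsto\xi(\mu)\mathbf{x}^\mu$, $\xi$ characters of $\mathbb{Z}^{r+1}/\Lambda_0$); for $f\in\mathcal{K}_{\bar\mu}$ with lift $\mu$: $\sigma_i(f)=\frac{\sigma_i.f}{1-v\mathbf{x}^{n\alpha_i}}[\mathbf{x}^{ -r_n(\mu_{i+1}-\mu_i)\alpha_i}(1-v)-v\,g_{1+\mu_{i+1}-\mu_i}\mathbf{x}^{(1-n)\alpha_i}(1-\mathbf{x}^{n\alpha_i})]$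 ($\sigma_i.$ swaps $x_i,x_{i+1}$), extended linearly. $\mathcal{D}_i(f)=\frac{f-\mathbf{x}^{n\alpha_i}\sigma_i(f)}{1-\mathbf{x}^{n\alpha_i}}$. -}

module Defs where

open import Level using (Level)
open import Data.Nat as ℕ using (ℕ; zero; suc; NonZero)
open import Data.Integer as ℤ using (ℤ; +_; -[1+_])
open import Data.Integer.DivMod using (_%ℕ_)
open import Data.Fin using (Fin; inject₁; fromℕ) renaming (_≟_ to _≟ᶠ_)
open import Data.Vec using (Vec; lookup; tabulate; zipWith; replicate)
open import Data.Vec.Properties using (≡-dec)
open import Data.List using (List; []; _∷_; _++_; map; foldr; concatMap; upTo)
open import Data.Product using (_×_; _,_)
open import Relation.Nullary using (yes; no)
open import Data.Bool using (if_then_else_)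
open import Relation.Nullary.Decidable using (⌊_⌋)
open import Relation.Binary.PropositionalEquality using (_≡_)
open import Algebra.Bundles using (CommutativeRing)

rₙ : (n : ℕ) .{{_ : NonZero n}} → ℤ → ℕ
rₙ n j = j %ℕ n

range1 : ℤ → List ℤ
range1 (+ m)    = map (λ k → + suc k) (upTo m)
range1 -[1+ _ ] = []

unitVec : {m : ℕ} → Fin m → ℤ → Vec ℤ m
unitVec p z = tabulate (λ q → if ⌊ q ≟ᶠ p ⌋ then z else + 0)

-- For i : Fin r (i.e. i = 1,…,r, 0-based), the positions of x_i and x_{i+1}
-- among x_1,…,x_{r+1}.
posL posR : {r : ℕ} → Fin r → Fin (suc r)
posL i = inject₁ i
posR i = Fin.suc i
  where import Data.Fin as Fin

multα : {r : ℕ} → Fin r → ℤ → Vec ℤ (suc r)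
multα i k = zipWith ℤ._+_ (unitVec (posL i) k) (unitVec (posR i) (ℤ.- k))

mono2 : {r : ℕ} → Fin r → ℤ → ℤ → Vec ℤ (suc r)
mono2 i e1 e2 = zipWith ℤ._+_ (unitVec (posL i) e1) (unitVec (posR i) e2)

swapExp : {r : ℕ} → Fin r → Vec ℤ (suc r) → Vec ℤ (suc r)
swapExp i μ = tabulate λ p →
  if ⌊ p ≟ᶠ posL i ⌋ then lookup μ (posR i)
  else if ⌊ p ≟ᶠ posR i ⌋ then lookup μ (posL i)
  else lookup μ p

module ChintaGunnells {c ℓ : Level} (R : CommutativeRing c ℓ) where
  open CommutativeRing R

  -- Laurent polynomials in x_1,…,x_m over R: finite formal sums Σ c·x^μ.
  LP : ℕ → Set c
  LP m = List (Carrier × Vec ℤ m)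

  coeff : {m : ℕ} → LP m → Vec ℤ m → Carrier
  coeff P ν = foldr step 0# P
    where
    step : _ → Carrier → Carrier
    step (a , μ) acc with ≡-dec ℤ._≟_ μ ν
    ... | yes _ = a + acc
    ... | no  _ = acc

  _≋_ : {m : ℕ} → LP m → LP m → Set ℓ
  P ≋ Q = ∀ ν → coeff P ν ≈ coeff Q ν

  monoLP : {m : ℕ} → Carrier → Vec ℤ m → LP m
  monoLP a μ = (a , μ) ∷ []

  constLP : {m : ℕ} → Carrier → LP m
  constLP a = monoLP a (replicate _ (+ 0))

  _⊕_ : {m : ℕ} → LP m → LP m → LP m
  P ⊕ Q = P ++ Q

  ⊖_ : {m : ℕ} → LP m → LP m
  ⊖ P = map (λ { (a , μ) → (- a , μ) }) P

  _⊗_ : {m : ℕ} → LP m → LP m → LP m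
  P ⊗ Q = concatMap (λ { (a , μ) → map (λ { (b , ν) → (a * b , zipWith ℤ._+_ μ ν) }) Q }) P

  -- Elements of the field of fractions ℂ(x): numerator / denominator.
  record Frac (m : ℕ) : Set c where
    constructor _/_
    field
      num : LP m
      den : LP m
  open Frac public

  toFrac : {m : ℕ} → LP m → Frac m
  toFrac P = P / constLP 1#

  _-F_ : {m : ℕ} → Frac m → Frac m → Frac m
  (a / b) -F (c' / d) = ((a ⊗ d) ⊕ (⊖ (c' ⊗ b))) / (b ⊗ d)

  _·F_ : {m : ℕ} → LP m → Frac m → Frac m
  p ·F (a / b) = (p ⊗ a) / b

  _÷F_ : {m : ℕ} → Frac m → LP m → Frac m
  (a / b) ÷F p = a / (b ⊗ p)

  IsZeroF : {m : ℕ} → Frac m → Set ℓ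
  IsZeroF (a / _) = a ≋ []

  module Action (n : ℕ) .{{_ : NonZero n}} (v : Carrier) (g : ℤ → Carrier) where

    xα : {r : ℕ} → Fin r → ℤ → LP (suc r)
    xα i k = monoLP 1# (multα i k)

    nℤ : ℤ
    nℤ = + n

    -- numerator of σ_i(a·x^μ) over the common denominator 1 − v x^{nα_i}
    σnumTerm : {r : ℕ} → Fin r → Carrier × Vec ℤ (suc r) → LP (suc r)
    σnumTerm i (a , μ) =
      monoLP a (swapExp i μ) ⊗
        ( (constLP (1# + - v) ⊗ xα i (ℤ.- (+ rₙ n d)))
        ⊕ (⊖ (constLP (v * g (+ 1 ℤ.+ d)) ⊗ (xα i (+ 1 ℤ.- nℤ) ⊗ (constLP 1# ⊕ (⊖ xα i nℤ))))) )
      where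
      d : ℤ
      d = lookup μ (posR i) ℤ.- lookup μ (posL i)

    σ : {r : ℕ} → Fin r → LP (suc r) → Frac (suc r)
    σ i f = concatMap (σnumTerm i) f / (constLP 1# ⊕ (⊖ (constLP v ⊗ xα i nℤ)))

    𝒟 : {r : ℕ} → Fin r → LP (suc r) → Frac (suc r)
    𝒟 i f = (toFrac f -F (xα i nℤ ·F σ i f)) ÷F (constLP 1# ⊕ (⊖ xα i nℤ))

    h♭ : ℤ → Carrier
    h♭ c' with rₙ n c' ℕ.≟ 0
    ... | yes _ = 1# + - v
    ... | no  _ = 0#

    g♭ : ℤ → Carrier
    g♭ c' = v * g c'

    δ : ℤ → ℤ → Carrier
    δ a c' with a ℤ.<? c' | a ℤ.≟ c'
    ... | yes _ | _     = 1# + - v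
    ... | no  _ | yes _ = - v
    ... | no  _ | no  _ = 0#

    hB : ℤ → ℤ → Carrier
    hB B c' with c' ℤ.<? B
    ... | yes _ = h♭ c'
    ... | no  _ = g♭ c'

    fAΓ : {r : ℕ} → Fin r → (a λ₂ λ₃ Γ₁₃ : ℤ) → LP (suc r)
    fAΓ i a λ₂ λ₃ Γ₁₃ =
      map (λ c' → (δ a c' * hB B c' , mono2 i (λ₃ ℤ.+ c' ℤ.- Γ₁₃) (λ₂ ℤ.+ a ℤ.- c'))) (range1 B)
      where
      B : ℤ
      B = Γ₁₃ ℤ.+ λ₂ ℤ.- λ₃ ℤ.+ + 1

{-# OPTIONS --safe #-}
-- All monomials of f lie on the line e ↦ x_{r-1}^{λ₃+e-Γ₁₃} x_r^{λ₂+a-e}, and σ_{r-1} sends the monomial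
-- at position c to monomials at positions s - c + (small shifts), s = B - 1 + a. So the coefficient at
-- position k of the numerator of 𝒟_{r-1} f is a sum over c = 1, …, B, which has to vanish for every k.
-- For c < B the weight h(c) is zero unless n ∣ c, and for those c the residue and the Gauss sum
-- occurring in σ do not depend on c, so these monomials contribute five translates of
-- K(t) = δ_a(t) h♭(t) [1 ≤ t < B]. When a < B one has K = u (u J - [· = a]) with u = 1 - v and
-- J the indicator of the multiples of n in [a, M], M the largest multiple of n below B; J telescopes,
-- J(t) - J(t - n) = [t = a] - [t = M + n], and is symmetric under t ↦ M + a - t. Together with the
-- monomial c = B all that is left is
--   u² g♭(B) ([k = a + B - M] - [k = E]) + u v (g♭(B) g(a - B) - 1) ([k = a] - [k = a + n]),
-- which vanishes: if n ∤ B then E = a + B - M and g_B g_{n-B} = v⁻¹; if n ∣ B then B - M = n,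
-- E = a and g_B = g_{a-B} = g_0 = -1. For a > B the factor δ_a kills every term, and for a = B
-- only c = B survives, where it cancels because g_0 = -1.

module Submission where

open import Level using (Level; _⊔_)
open import Algebra.Bundles using (CommutativeRing)
open import Relation.Binary.Bundles using (Setoid)
open import Algebra.Solver.Ring.AlmostCommutativeRing using (fromCommutativeRing; _-Raw-AlmostCommutative⟶_)
open import Data.Bool using (if_then_else_)
open import Data.Empty using (⊥-elim)
open import Data.Fin using (Fin; inject₁; fromℕ; toℕ) renaming (_≟_ to _≟ᶠ_)
import Data.Fin.Properties as FinP
open import Data.Integer as ℤ using (ℤ; +_; -[1+_])
import Data.Integer.Divisibility as ℤd
open import Data.Integer.Divisibility.Signed
  using (_∣_; _∣?_; divides; ∣ᵤ⇒∣; ∣⇒∣ᵤ; ∣m∣n⇒∣m+n; ∣m∣n⇒∣m-n; ∣m⇒∣-m; ∣-refl)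
open import Data.Integer.DivMod using (_/ℕ_; n%ℕd<d; a≡a%ℕn+[a/ℕn]*n)
import Data.Integer.Properties as ℤP
open import Data.Integer.Tactic.RingSolver using (solve-∀)
open import Data.List using (List; []; _∷_; _++_; [_]; map; concatMap; upTo)
open import Data.List.Membership.Propositional using (_∈_)
open import Data.List.Membership.Propositional.Properties using (∈-map⁻; ∈-upTo⁻)
import Data.List.Properties as ListP
open import Data.List.Relation.Unary.Any using (here; there)
open import Data.Maybe using (Maybe; just; nothing)
open import Data.Nat as ℕ using (ℕ; zero; suc; NonZero)
import Data.Nat.Divisibility as ℕd
import Data.Nat.Properties as ℕP
open import Data.Product using (_×_; _,_; proj₁; proj₂)
open import Data.Sum using (inj₁; inj₂)
open import Data.Vec using (Vec; lookup; zipWith; replicate)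
open import Data.Vec.Properties using (≡-dec)
import Data.Vec.Properties as VecP
open import Function using (_∘_)
open import Relation.Binary.Definitions using (Tri; tri<; tri≈; tri>)
import Relation.Binary.PropositionalEquality as P
open P using (_≡_; _≢_)
open import Relation.Nullary using (Dec; yes; no; ¬_)
open import Relation.Nullary.Decidable using (⌊_⌋)
open import Defs

-- A ring solver for R whose constants normalise by computation: coefficients are integers,
-- interpreted through the canonical map ℤ → R.
module IntegerCoefficients {c ℓ : Level} (R : CommutativeRing c ℓ) where
  open CommutativeRing R
  open import Algebra.Properties.Ring ring using (-‿involutive; -0#≈0#; -‿distribˡ-*; -‿distribʳ-*)
  open import Algebra.Properties.AbelianGroup +-abelianGroup using (⁻¹-∙-comm)
  open import Algebra.Properties.Semiring.Mult.TCOptimised semiring using (×-homo-+; ×1-homo-*) renaming (_×_ to _·_)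
  open import Relation.Binary.Reasoning.Setoid setoid

  ⟦_⟧ℤ : ℤ → Carrier
  ⟦ + m ⟧ℤ      = m · 1#
  ⟦ -[1+ m ] ⟧ℤ = - (suc m · 1#)

  -‿homo : ∀ z → ⟦ ℤ.- z ⟧ℤ ≈ - ⟦ z ⟧ℤ
  -‿homo (+ zero)  = sym -0#≈0#
  -‿homo (+ suc m) = refl
  -‿homo -[1+ m ]  = sym (-‿involutive _)

  ⊖-homo : ∀ m n → ⟦ m ℤ.⊖ n ⟧ℤ ≈ m · 1# + - (n · 1#)
  ⊖-homo m       zero    = sym (trans (+-congˡ -0#≈0#) (+-identityʳ _))
  ⊖-homo zero    (suc n) = sym (+-identityˡ _)
  ⊖-homo (suc m) (suc n) = begin
    ⟦ suc m ℤ.⊖ suc n ⟧ℤ              ≡⟨ P.cong ⟦_⟧ℤ (ℤP.[1+m]⊖[1+n]≡m⊖n m n) ⟩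
    ⟦ m ℤ.⊖ n ⟧ℤ                      ≈⟨ ⊖-homo m n ⟩
    m · 1# + - (n · 1#)                 ≈⟨ +-congʳ (add-and-subtract-1# (m · 1#)) ⟩
    (1# + m · 1#) + - 1# + - (n · 1#)   ≈⟨ +-assoc _ _ _ ⟩
    (1# + m · 1#) + (- 1# + - (n · 1#)) ≈⟨ +-cong (sym (×-homo-+ 1# 1 m)) (⁻¹-∙-comm 1# (n · 1#)) ⟩
    suc m · 1# + - (1# + n · 1#)        ≈⟨ +-congˡ (-‿cong (sym (×-homo-+ 1# 1 n))) ⟩
    suc m · 1# + - (suc n · 1#)         ∎
    where
    add-and-subtract-1# : ∀ x → x ≈ (1# + x) + - 1#
    add-and-subtract-1# x = sym (begin
      (1# + x) + - 1#   ≈⟨ +-congʳ (+-comm 1# x) ⟩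
      (x + 1#) + - 1#   ≈⟨ +-assoc x 1# (- 1#) ⟩
      x + (1# + - 1#)   ≈⟨ +-congˡ (-‿inverseʳ 1#) ⟩
      x + 0#            ≈⟨ +-identityʳ x ⟩
      x                 ∎)

  +-homo : ∀ x y → ⟦ x ℤ.+ y ⟧ℤ ≈ ⟦ x ⟧ℤ + ⟦ y ⟧ℤ
  +-homo (+ m)    (+ n)    = ×-homo-+ 1# m n
  +-homo (+ m)    -[1+ n ] = ⊖-homo m (suc n)
  +-homo -[1+ m ] (+ n)    = trans (⊖-homo n (suc m)) (+-comm _ _)
  +-homo -[1+ m ] -[1+ n ] = begin
    - (suc (suc (m ℕ.+ n)) · 1#)       ≡⟨ P.cong (λ k → - (k · 1#)) (ℕP.+-suc (suc m) n) ⟨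
    - ((suc m ℕ.+ suc n) · 1#)         ≈⟨ -‿cong (×-homo-+ 1# (suc m) (suc n)) ⟩
    - (suc m · 1# + suc n · 1#)        ≈⟨ ⁻¹-∙-comm _ _ ⟨
    - (suc m · 1#) + - (suc n · 1#)    ∎

  *-homo : ∀ x y → ⟦ x ℤ.* y ⟧ℤ ≈ ⟦ x ⟧ℤ * ⟦ y ⟧ℤ
  *-homo (+ m) (+ n) = trans (reflexive (P.cong ⟦_⟧ℤ (ℤP.+◃n≡+n (m ℕ.* n)))) (×1-homo-* m n)
  *-homo (+ zero) -[1+ n ] = sym (zeroˡ _)
  *-homo (+ suc m) -[1+ n ] =
    trans (-‿homo (+ (suc m ℕ.* suc n))) (trans (-‿cong (×1-homo-* (suc m) (suc n))) (-‿distribʳ-* _ _))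
  *-homo -[1+ m ] (+ zero) = trans (reflexive (P.cong ⟦_⟧ℤ (ℤP.*-zeroʳ -[1+ m ]))) (sym (zeroʳ _))
  *-homo -[1+ m ] (+ suc n) =
    trans (-‿homo (+ (suc m ℕ.* suc n))) (trans (-‿cong (×1-homo-* (suc m) (suc n))) (-‿distribˡ-* _ _))
  *-homo -[1+ m ] -[1+ n ] = begin
    (suc m ℕ.* suc n) · 1#               ≈⟨ ×1-homo-* (suc m) (suc n) ⟩
    suc m · 1# * suc n · 1#              ≈⟨ -‿involutive _ ⟨
    - - (suc m · 1# * suc n · 1#)        ≈⟨ -‿cong (-‿distribˡ-* _ _) ⟩
    - (- (suc m · 1#) * suc n · 1#)      ≈⟨ -‿distribʳ-* _ _ ⟩
    - (suc m · 1#) * - (suc n · 1#)      ∎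

  ⟦⟧-morphism : ℤ.+-*-rawRing -Raw-AlmostCommutative⟶ fromCommutativeRing R
  ⟦⟧-morphism = record
    { ⟦_⟧ = ⟦_⟧ℤ ; +-homo = +-homo ; *-homo = *-homo ; -‿homo = -‿homo ; 0-homo = refl ; 1-homo = refl }

  ⟦⟧-≟ : ∀ x y → Maybe (⟦ x ⟧ℤ ≈ ⟦ y ⟧ℤ)
  ⟦⟧-≟ x y with x ℤ.≟ y
  ... | yes P.refl = just refl
  ... | no _       = nothing

  open import Algebra.Solver.Ring ℤ.+-*-rawRing (fromCommutativeRing R) ⟦⟧-morphism ⟦⟧-≟ public
    using (solve; _:=_; _:+_; _:*_; :-_; con)

module Sums {c ℓ : Level} (R : CommutativeRing c ℓ) where
  open CommutativeRing R
  open import Algebra.Properties.Ring ring using (-0#≈0#; -‿distribˡ-*)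
  open import Algebra.Properties.AbelianGroup +-abelianGroup using (⁻¹-∙-comm)
  open IntegerCoefficients R
  open import Relation.Binary.Reasoning.Setoid setoid

  𝟙 : {p : Level} {Q : Set p} → Dec Q → Carrier
  𝟙 (yes _) = 1#
  𝟙 (no _)  = 0#

  𝟙-yes : {p : Level} {Q : Set p} → Q → (d : Dec Q) → 𝟙 d ≡ 1#
  𝟙-yes q (yes _) = P.refl
  𝟙-yes q (no ¬q) = ⊥-elim (¬q q)

  𝟙-no : {p : Level} {Q : Set p} → ¬ Q → (d : Dec Q) → 𝟙 d ≡ 0#
  𝟙-no ¬q (yes q) = ⊥-elim (¬q q)
  𝟙-no ¬q (no _)  = P.refl

  𝟙-⇔ : {p q : Level} {Q : Set p} {Q′ : Set q} → (Q → Q′) → (Q′ → Q) → (d : Dec Q) (d′ : Dec Q′) → 𝟙 d ≡ 𝟙 d′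
  𝟙-⇔ f g (yes x) (yes y) = P.refl
  𝟙-⇔ f g (yes x) (no ¬y) = ⊥-elim (¬y (f x))
  𝟙-⇔ f g (no ¬x) (yes y) = ⊥-elim (¬x (g y))
  𝟙-⇔ f g (no _)  (no _)  = P.refl

  𝟙-≟-sym : ∀ x y → 𝟙 (x ℤ.≟ y) ≡ 𝟙 (y ℤ.≟ x)
  𝟙-≟-sym x y = 𝟙-⇔ P.sym P.sym (x ℤ.≟ y) (y ℤ.≟ x)

  𝟙-≟-by-difference : ∀ x y z w → x ℤ.- y ≡ z ℤ.- w → 𝟙 (x ℤ.≟ y) ≡ 𝟙 (z ℤ.≟ w)
  𝟙-≟-by-difference x y z w e = 𝟙-⇔
    (λ x≡y → ℤP.i-j≡0⇒i≡j z w (P.trans (P.sym e) (ℤP.i≡j⇒i-j≡0 x≡y)))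
    (λ z≡w → ℤP.i-j≡0⇒i≡j x y (P.trans e (ℤP.i≡j⇒i-j≡0 z≡w))) (x ℤ.≟ y) (z ℤ.≟ w)

  ∑ : {a : Level} {A : Set a} → List A → (A → Carrier) → Carrier
  ∑ []       F = 0#
  ∑ (x ∷ xs) F = F x + ∑ xs F

  module _ {a : Level} {A : Set a} where

    ∑-cong-∈ : (xs : List A) {F G : A → Carrier} → (∀ {x} → x ∈ xs → F x ≈ G x) → ∑ xs F ≈ ∑ xs G
    ∑-cong-∈ []       h = refl
    ∑-cong-∈ (x ∷ xs) h = +-cong (h (here P.refl)) (∑-cong-∈ xs (h ∘ there))

    ∑-cong : (xs : List A) {F G : A → Carrier} → (∀ x → F x ≈ G x) → ∑ xs F ≈ ∑ xs G
    ∑-cong xs h = ∑-cong-∈ xs (λ {x} _ → h x)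

    ∑-zero : (xs : List A) {F : A → Carrier} → (∀ x → F x ≈ 0#) → ∑ xs F ≈ 0#
    ∑-zero []       h = refl
    ∑-zero (x ∷ xs) h = trans (+-cong (h x) (∑-zero xs h)) (+-identityˡ _)

    ∑-++ : (xs ys : List A) (F : A → Carrier) → ∑ (xs ++ ys) F ≈ ∑ xs F + ∑ ys F
    ∑-++ []       ys F = sym (+-identityˡ _)
    ∑-++ (x ∷ xs) ys F = trans (+-congˡ (∑-++ xs ys F)) (sym (+-assoc _ _ _))

    ∑-+ : (xs : List A) (F G : A → Carrier) → ∑ xs (λ x → F x + G x) ≈ ∑ xs F + ∑ xs G
    ∑-+ []       F G = sym (+-identityˡ _)
    ∑-+ (x ∷ xs) F G = trans (+-congˡ (∑-+ xs F G))
      (solve 4 (λ f g s t → (f :+ g) :+ (s :+ t) := (f :+ s) :+ (g :+ t)) refl (F x) (G x) (∑ xs F) (∑ xs G))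

    ∑-*ˡ : (xs : List A) (k : Carrier) (F : A → Carrier) → ∑ xs (λ x → k * F x) ≈ k * ∑ xs F
    ∑-*ˡ []       k F = sym (zeroʳ _)
    ∑-*ˡ (x ∷ xs) k F = trans (+-congˡ (∑-*ˡ xs k F)) (sym (distribˡ _ _ _))

    ∑-neg : (xs : List A) (F : A → Carrier) → ∑ xs (λ x → - F x) ≈ - ∑ xs F
    ∑-neg []       F = sym -0#≈0#
    ∑-neg (x ∷ xs) F = trans (+-congˡ (∑-neg xs F)) (⁻¹-∙-comm _ _)

  module _ {a b : Level} {A : Set a} {B : Set b} where

    ∑-map : (h : A → B) (xs : List A) (F : B → Carrier) → ∑ (map h xs) F ≈ ∑ xs (F ∘ h)
    ∑-map h []       F = refl
    ∑-map h (x ∷ xs) F = +-congˡ (∑-map h xs F)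

    ∑-concatMap : (h : A → List B) (xs : List A) (F : B → Carrier) →
      ∑ (concatMap h xs) F ≈ ∑ xs (λ x → ∑ (h x) F)
    ∑-concatMap h []       F = refl
    ∑-concatMap h (x ∷ xs) F = trans (∑-++ (h x) (concatMap h xs) F) (+-congˡ (∑-concatMap h xs F))

  range1-suc : ∀ m → range1 (+ suc m) ≡ range1 (+ m) ++ [ + suc m ]
  range1-suc m = P.trans (P.cong (map (λ k → + suc k)) (P.sym (ListP.applyUpTo-∷ʳ (λ k → k) m)))
                         (ListP.map-++ (λ k → + suc k) (upTo m) [ m ])

  ∈-range1 : ∀ {m t} → t ∈ range1 (+ m) → + 1 ℤ.≤ t × t ℤ.≤ + m
  ∈-range1 t∈ with ∈-map⁻ (λ k → + suc k) t∈
  ... | j , j∈ , P.refl = ℤ.+≤+ (ℕ.s≤s ℕ.z≤n) , ℤ.+≤+ (∈-upTo⁻ j∈)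

  point : ℤ → ℤ → Carrier
  point t c = 𝟙 (c ℤ.≟ t)

  window : ℕ → ℤ → Carrier
  window m t = 𝟙 (+ 1 ℤ.≤? t) * 𝟙 (t ℤ.≤? + m)

  ∑-range1-point : ∀ m (G : ℤ → Carrier) t → ∑ (range1 (+ m)) (λ c → G c * point t c) ≈ window m t * G t
  ∑-range1-point zero G t with + 1 ℤ.≤? t | t ℤ.≤? + 0
  ... | yes 1≤t | yes t≤0 = ⊥-elim (ℕP.1+n≰n (ℤP.drop‿+≤+ (ℤP.≤-trans 1≤t t≤0)))
  ... | yes _   | no _    = sym (trans (*-congʳ (zeroʳ _)) (zeroˡ _))
  ... | no _    | _       = sym (trans (*-congʳ (zeroˡ _)) (zeroˡ _))
  ∑-range1-point (suc m) G t = begin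
    ∑ (range1 (+ suc m)) F                  ≡⟨ P.cong (λ cs → ∑ cs F) (range1-suc m) ⟩
    ∑ (range1 (+ m) ++ [ + suc m ]) F       ≈⟨ ∑-++ (range1 (+ m)) [ + suc m ] F ⟩
    ∑ (range1 (+ m)) F + (F (+ suc m) + 0#) ≈⟨ +-cong (∑-range1-point m G t) (+-identityʳ _) ⟩
    window m t * G t + F (+ suc m)          ≈⟨ add-last (+ suc m ℤ.≟ t) ⟩
    window (suc m) t * G t                  ∎
    where
    F : ℤ → Carrier
    F c = G c * point t c
    add-last : (d : Dec (+ suc m ≡ t)) → window m t * G t + G (+ suc m) * 𝟙 d ≈ window (suc m) t * G t
    add-last (yes P.refl)
      rewrite 𝟙-yes (ℤ.+≤+ (ℕ.s≤s ℕ.z≤n)) (+ 1 ℤ.≤? + suc m) | 𝟙-no (ℤP.<⇒≱ (ℤ.+<+ (ℕP.n<1+n m))) (+ suc m ℤ.≤? + m)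
            | 𝟙-yes ℤP.≤-refl (+ suc m ℤ.≤? + suc m) =
      solve 1 (λ x → (con (+ 1) :* con (+ 0)) :* x :+ x :* con (+ 1) := (con (+ 1) :* con (+ 1)) :* x) refl (G (+ suc m))
    add-last (no ≢t) = trans (+-congˡ (zeroʳ _)) (trans (+-identityʳ _)
      (*-congʳ (*-congˡ (reflexive (𝟙-⇔ (λ t≤m → ℤP.≤-trans t≤m (ℤ.+≤+ (ℕP.n≤1+n m)))
        (λ t≤1+m → ℤP.i<j⇒i≤pred[j] (ℤP.≤∧≢⇒< t≤1+m (≢t ∘ P.sym))) (t ℤ.≤? + m) (t ℤ.≤? + suc m))))))

module PairExponents {r : ℕ} (i : Fin r) where

  posL≢posR : ¬ (posL i ≡ posR i)
  posL≢posR e = ℕP.<-irrefl (P.cong toℕ e) (P.subst (ℕ._< suc (toℕ i)) (P.sym (FinP.toℕ-inject₁ i)) (ℕP.n<1+n (toℕ i)))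

  pairEntry : Fin (suc r) → ℤ → ℤ → ℤ
  pairEntry j x y with j ≟ᶠ posL i | j ≟ᶠ posR i
  ... | yes _ | _     = x
  ... | no _  | yes _ = y
  ... | no _  | no _  = + 0

  lookup-mono2 : ∀ x y j → lookup (mono2 i x y) j ≡ pairEntry j x y
  lookup-mono2 x y j
    rewrite VecP.lookup-zipWith ℤ._+_ j (unitVec (posL i) x) (unitVec (posR i) y)
          | VecP.lookup∘tabulate (λ q → if ⌊ q ≟ᶠ posL i ⌋ then x else + 0) j
          | VecP.lookup∘tabulate (λ q → if ⌊ q ≟ᶠ posR i ⌋ then y else + 0) j
    with j ≟ᶠ posL i | j ≟ᶠ posR i
  ... | yes j≡L | yes j≡R = ⊥-elim (posL≢posR (P.trans (P.sym j≡L) j≡R))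
  ... | yes _   | no _    = ℤP.+-identityʳ x
  ... | no _    | yes _   = ℤP.+-identityˡ y
  ... | no _    | no _    = P.refl

  lookup-mono2-posL : ∀ x y → lookup (mono2 i x y) (posL i) ≡ x
  lookup-mono2-posL x y rewrite lookup-mono2 x y (posL i) with posL i ≟ᶠ posL i
  ... | yes _ = P.refl
  ... | no ≢  = ⊥-elim (≢ P.refl)

  lookup-mono2-posR : ∀ x y → lookup (mono2 i x y) (posR i) ≡ y
  lookup-mono2-posR x y rewrite lookup-mono2 x y (posR i) with posR i ≟ᶠ posL i | posR i ≟ᶠ posR i
  ... | yes R≡L | _     = ⊥-elim (posL≢posR (P.sym R≡L))
  ... | no _    | yes _ = P.refl
  ... | no _    | no ≢  = ⊥-elim (≢ P.refl)

  mono2-ext : ∀ {u} x y → (∀ j → lookup u j ≡ pairEntry j x y) → u ≡ mono2 i x y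
  mono2-ext {u} x y h = P.trans (P.sym (VecP.tabulate∘lookup u))
    (P.trans (VecP.tabulate-cong (λ j → P.trans (h j) (P.sym (lookup-mono2 x y j)))) (VecP.tabulate∘lookup (mono2 i x y)))

  replicate-mono2 : replicate (suc r) (+ 0) ≡ mono2 i (+ 0) (+ 0)
  replicate-mono2 = mono2-ext (+ 0) (+ 0) entry
    where
    entry : ∀ j → lookup (replicate (suc r) (+ 0)) j ≡ pairEntry j (+ 0) (+ 0)
    entry j rewrite VecP.lookup-replicate j (+ 0) with j ≟ᶠ posL i | j ≟ᶠ posR i
    ... | yes _ | _     = P.refl
    ... | no _  | yes _ = P.refl
    ... | no _  | no _  = P.refl

  zipWith-mono2 : ∀ {u w x y x′ y′} → u ≡ mono2 i x y → w ≡ mono2 i x′ y′ →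
    zipWith ℤ._+_ u w ≡ mono2 i (x ℤ.+ x′) (y ℤ.+ y′)
  zipWith-mono2 {x = x} {y} {x′} {y′} P.refl P.refl = mono2-ext (x ℤ.+ x′) (y ℤ.+ y′) entry
    where
    entry : ∀ j → lookup (zipWith ℤ._+_ (mono2 i x y) (mono2 i x′ y′)) j ≡ pairEntry j (x ℤ.+ x′) (y ℤ.+ y′)
    entry j rewrite VecP.lookup-zipWith ℤ._+_ j (mono2 i x y) (mono2 i x′ y′) | lookup-mono2 x y j | lookup-mono2 x′ y′ j
      with j ≟ᶠ posL i | j ≟ᶠ posR i
    ... | yes _ | _     = P.refl
    ... | no _  | yes _ = P.refl
    ... | no _  | no _  = P.refl

  swapExp-mono2 : ∀ {u x y} → u ≡ mono2 i x y → swapExp i u ≡ mono2 i y x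
  swapExp-mono2 {x = x} {y} P.refl = mono2-ext y x entry
    where
    entry : ∀ j → lookup (swapExp i (mono2 i x y)) j ≡ pairEntry j y x
    entry j rewrite VecP.lookup∘tabulate (λ p →
        if ⌊ p ≟ᶠ posL i ⌋ then lookup (mono2 i x y) (posR i)
        else if ⌊ p ≟ᶠ posR i ⌋ then lookup (mono2 i x y) (posL i)
        else lookup (mono2 i x y) p) j
      with j ≟ᶠ posL i | j ≟ᶠ posR i | lookup-mono2 x y j
    ... | yes _ | _     | _ = lookup-mono2-posR x y
    ... | no _  | yes _ | _ = lookup-mono2-posL x y
    ... | no _  | no _  | e = e

∣-resp-≡ : ∀ {k x y} → k ∣ x → x ≡ y → k ∣ y
∣-resp-≡ k∣x P.refl = k∣x

pos-∸ : ∀ {x y} → y ℕ.≤ x → + (x ℕ.∸ y) ≡ + x ℤ.- + y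
pos-∸ {x} {y} y≤x = P.sym (P.trans (ℤP.m-n≡m⊖n x y) (ℤP.⊖-≥ y≤x))

reflect-≤ : ∀ c {x y} → x ℤ.≤ y → c ℤ.- y ℤ.≤ c ℤ.- x
reflect-≤ c x≤y = ℤP.+-monoʳ-≤ c (ℤP.neg-mono-≤ x≤y)

module Residues (n : ℕ) .{{_ : NonZero n}} where
  open import Data.Integer using (_+_; _-_; _*_; -_; _≤_; _<_)

  n∣x-rₙx : ∀ x → + n ∣ x - + rₙ n x
  n∣x-rₙx x = divides (x /ℕ n) (begin
    x - + rₙ n x                            ≡⟨ P.cong (_- + rₙ n x) (a≡a%ℕn+[a/ℕn]*n x n) ⟩
    + rₙ n x + (x /ℕ n) * + n - + rₙ n x    ≡⟨ lemma (+ rₙ n x) ((x /ℕ n) * + n) ⟩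
    (x /ℕ n) * + n                          ∎)
    where
    open P.≡-Reasoning
    lemma : ∀ a b → a + b - a ≡ b
    lemma = solve-∀

  rₙ<n : ∀ x → rₙ n x ℕ.< n
  rₙ<n x = n%ℕd<d x n

  private
    residues-≤ : ∀ s t → s ℕ.≤ t → t ℕ.< n → + n ∣ + t - + s → s ≡ t
    residues-≤ s t s≤t t<n n∣t-s with t ℕ.∸ s in t∸s
    ... | zero  = ℕP.≤-antisym s≤t (ℕP.m∸n≡0⇒m≤n t∸s)
    ... | suc _ = ⊥-elim (ℕP.<⇒≱ t<n (ℕP.≤-trans (ℕd.∣⇒≤ (P.subst (n ℕd.∣_) t∸s n∣t∸s)) (P.subst (ℕ._≤ t) t∸s (ℕP.m∸n≤m t s))))
      where
      n∣t∸s : n ℕd.∣ t ℕ.∸ s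
      n∣t∸s = ∣⇒∣ᵤ (∣-resp-≡ n∣t-s (P.trans (ℤP.m-n≡m⊖n t s) (ℤP.⊖-≥ s≤t)))

  residues-unique : ∀ s t → s ℕ.< n → t ℕ.< n → + n ∣ + s - + t → s ≡ t
  residues-unique s t s<n t<n n∣s-t with ℕP.≤-total s t
  ... | inj₁ s≤t = residues-≤ s t s≤t t<n (∣-resp-≡ (∣m⇒∣-m n∣s-t) (lemma (+ s) (+ t)))
    where
    lemma : ∀ a b → - (a - b) ≡ b - a
    lemma = solve-∀
  ... | inj₂ t≤s = P.sym (residues-≤ t s t≤s s<n n∣s-t)

  rₙ-unique : ∀ x t → t ℕ.< n → + n ∣ x - + t → rₙ n x ≡ t
  rₙ-unique x t t<n n∣x-t = residues-unique (rₙ n x) t (rₙ<n x) t<n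
    (∣-resp-≡ (∣m∣n⇒∣m-n n∣x-t (n∣x-rₙx x)) (lemma x (+ t) (+ rₙ n x)))
    where
    lemma : ∀ a b c → (a - b) - (a - c) ≡ c - b
    lemma = solve-∀

  rₙ≡0⇒∣ : ∀ x → rₙ n x ≡ 0 → + n ∣ x
  rₙ≡0⇒∣ x r≡0 = ∣-resp-≡ (n∣x-rₙx x) (P.trans (P.cong (λ r → x - + r) r≡0) (ℤP.+-identityʳ x))

  ∣⇒rₙ≡0 : ∀ x → + n ∣ x → rₙ n x ≡ 0
  ∣⇒rₙ≡0 x n∣x = rₙ-unique x 0 (ℕ.>-nonZero⁻¹ n) (∣-resp-≡ n∣x (P.sym (ℤP.+-identityʳ x)))

  rₙ-cong : ∀ x y → + n ∣ x - y → rₙ n x ≡ rₙ n y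
  rₙ-cong x y n∣x-y = rₙ-unique x (rₙ n y) (rₙ<n y) (∣-resp-≡ (∣m∣n⇒∣m+n n∣x-y (n∣x-rₙx y)) (lemma x y (+ rₙ n y)))
    where
    lemma : ∀ a b c → (a - b) + (b - c) ≡ a - c
    lemma = solve-∀

  x<x+n : ∀ x → x < x + + n
  x<x+n x = P.subst (_< x + + n) (ℤP.+-identityʳ x) (ℤP.+-monoʳ-< x (ℤ.+<+ (ℕ.>-nonZero⁻¹ n)))

  multiples-gap : ∀ {x y} → + n ∣ x → + n ∣ y → x < y → x + + n ≤ y
  multiples-gap {x} {y} (divides p P.refl) (divides q P.refl) x<y = begin
    p * + n + + n       ≡⟨ lemma p (+ n) ⟩
    (+ 1 + p) * + n     ≤⟨ ℤP.*-monoʳ-≤-nonNeg (+ n) (ℤP.i<j⇒suc[i]≤j (ℤP.*-cancelʳ-<-nonNeg {p} {q} (+ n) x<y)) ⟩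
    q * + n             ∎
    where
    open ℤP.≤-Reasoning
    lemma : ∀ a b → a * b + b ≡ (+ 1 + a) * b
    lemma = solve-∀

module Periodic {a ℓ : Level} (S : Setoid a ℓ) (n : ℕ) (g : ℤ → Setoid.Carrier S)
  (g-periodic : ∀ j → Setoid._≈_ S (g (j ℤ.+ + n)) (g j)) where
  open Setoid S using (_≈_; reflexive; sym; trans)
  open import Data.Integer using (_+_; _-_; _*_; -_)

  g-+multiple : ∀ j k → g (j + + k * + n) ≈ g j
  g-+multiple j zero    = reflexive (P.cong g (lemma₀ j (+ n)))
    where
    lemma₀ : ∀ j n → j + + 0 * n ≡ j
    lemma₀ = solve-∀
  g-+multiple j (suc k) = trans (reflexive (P.cong g (lemma₁ j (+ k) (+ n)))) (trans (g-periodic _) (g-+multiple j k))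
    where
    lemma₁ : ∀ j k n → j + (+ 1 + k) * n ≡ j + k * n + n
    lemma₁ = solve-∀

  g-resp-∣ : ∀ x y → + n ∣ x - y → g x ≈ g y
  g-resp-∣ x y (divides (+ k) x-y≡kn) =
    trans (reflexive (P.cong g (P.trans (lemma₁ x y) (P.cong (λ z → y + z) x-y≡kn)))) (g-+multiple y k)
    where
    lemma₁ : ∀ x y → x ≡ y + (x - y)
    lemma₁ = solve-∀
  g-resp-∣ x y (divides -[1+ k ] x-y≡-kn) =
    sym (trans (reflexive (P.cong g (P.trans (lemma₁ x y) (P.trans (P.cong (λ z → x - z) x-y≡-kn) (lemma₂ x (+ suc k) (+ n))))))
               (g-+multiple x (suc k)))
    where
    lemma₁ : ∀ x y → y ≡ x - (x - y)
    lemma₁ = solve-∀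
    lemma₂ : ∀ x q n → x - (- q * n) ≡ x + q * n
    lemma₂ = solve-∀

module _ {c ℓ : Level} (R : CommutativeRing c ℓ) where
  open CommutativeRing R

  record GaussSums (n : ℕ) (v : Carrier) : Set (c ⊔ ℓ) where
    field
      g            : ℤ → Carrier
      g-periodic   : ∀ j → g (j ℤ.+ + n) ≈ g j
      g-zero       : g (+ 0) ≈ - 1#
      g-reflection : ∀ j → ¬ (+ n ℤd.∣ j) → v * (g j * g (+ n ℤ.- j)) ≈ 1#

module LineCoefficients {c ℓ : Level} (R : CommutativeRing c ℓ) (n : ℕ) .{{_ : NonZero n}}
  (v : CommutativeRing.Carrier R) (g : ℤ → CommutativeRing.Carrier R) where
  open CommutativeRing R
  open import Algebra.Properties.Ring ring using (-0#≈0#; -‿distribˡ-*)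
  open import Algebra.Properties.AbelianGroup +-abelianGroup using (⁻¹-∙-comm)
  open IntegerCoefficients R
  open Sums R
  open ChintaGunnells R
  open Action n v g

  profile : (G x₁ x₂ x₃ x₄ x₅ : Carrier) → Carrier
  profile G x₁ x₂ x₃ x₄ x₅ = x₁ + - (v * x₂) + - ((1# + - v) * x₃ + - (G * x₄) + G * x₅)

  profile-cong : ∀ {G G′ x₁ x₂ x₃ x₄ x₅ y₁ y₂ y₃ y₄ y₅} → G ≈ G′ →
    x₁ ≈ y₁ → x₂ ≈ y₂ → x₃ ≈ y₃ → x₄ ≈ y₄ → x₅ ≈ y₅ → profile G x₁ x₂ x₃ x₄ x₅ ≈ profile G′ y₁ y₂ y₃ y₄ y₅
  profile-cong eG e₁ e₂ e₃ e₄ e₅ = +-cong (+-cong e₁ (-‿cong (*-congˡ e₂)))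
    (-‿cong (+-cong (+-cong (*-congˡ e₃) (-‿cong (*-cong eG e₄))) (*-cong eG e₅)))

  -- For the monomial m at position c on a line that σ_i reflects about s, Ψ s β c is the functional β
  -- (on positions) applied to the numerator (1 - v x^{nα}) m - x^{nα} σnumTerm m of 𝒟_i m.
  Ψ : ℤ → (ℤ → Carrier) → ℤ → Carrier
  Ψ s β c = profile (v * g (+ 1 ℤ.+ (s ℤ.- c ℤ.- c)))
    (β c) (β (c ℤ.+ + n)) (β (s ℤ.- c ℤ.+ + n ℤ.- + rₙ n (s ℤ.- c ℤ.- c))) (β (s ℤ.- c ℤ.+ + 1)) (β (s ℤ.- c ℤ.+ + 1 ℤ.+ + n))

  coeff-∑ : ∀ {m} (P : LP m) ν → coeff P ν ≈ ∑ P (λ t → proj₁ t * 𝟙 (≡-dec ℤ._≟_ (proj₂ t) ν))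
  coeff-∑ []            ν = refl
  coeff-∑ ((a , μ) ∷ P) ν with ≡-dec ℤ._≟_ μ ν
  ... | yes _ = +-cong (sym (*-identityʳ a)) (coeff-∑ P ν)
  ... | no _  = trans (coeff-∑ P ν) (sym (trans (+-congʳ (zeroʳ a)) (+-identityˡ _)))

  module _ {r : ℕ} (i : Fin r) where
    private
      Term : Set c
      Term = Carrier × Vec ℤ (suc r)
      0ᵛ : Vec ℤ (suc r)
      0ᵛ = replicate (suc r) (+ 0)

    ∑-xα⊗ : ∀ k (Q : LP (suc r)) (F : Term → Carrier) →
      ∑ (xα i k ⊗ Q) F ≈ ∑ Q (λ t → F (1# * proj₁ t , zipWith ℤ._+_ (multα i k) (proj₂ t)))
    ∑-xα⊗ k []      F = refl
    ∑-xα⊗ k (t ∷ Q) F = +-congˡ (∑-xα⊗ k Q F)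

    ∑-⊗1 : ∀ (Q : LP (suc r)) (F : Term → Carrier) →
      ∑ (Q ⊗ constLP 1#) F ≈ ∑ Q (λ t → F (proj₁ t * 1# , zipWith ℤ._+_ (proj₂ t) 0ᵛ) + 0#)
    ∑-⊗1 []      F = refl
    ∑-⊗1 (t ∷ Q) F = +-cong (sym (+-identityʳ _)) (∑-⊗1 Q F)

    ∑-⊗[1-vxα] : ∀ k (Q : LP (suc r)) (F : Term → Carrier) →
      ∑ (Q ⊗ (constLP 1# ⊕ (⊖ (constLP v ⊗ xα i k)))) F
        ≈ ∑ Q (λ t → F (proj₁ t * 1# , zipWith ℤ._+_ (proj₂ t) 0ᵛ)
                   + (F (proj₁ t * (- (v * 1#)) , zipWith ℤ._+_ (proj₂ t) (zipWith ℤ._+_ 0ᵛ (multα i k))) + 0#))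
    ∑-⊗[1-vxα] k []      F = refl
    ∑-⊗[1-vxα] k (t ∷ Q) F = trans (+-congˡ (+-congˡ (∑-⊗[1-vxα] k Q F)))
      (trans (sym (+-assoc _ _ _)) (+-congʳ (+-congˡ (sym (+-identityʳ _)))))

    ∑-⊖ : ∀ (Q : LP (suc r)) (F : Term → Carrier) → (∀ a μ → F (- a , μ) ≈ - F (a , μ)) → ∑ (⊖ Q) F ≈ - ∑ Q F
    ∑-⊖ []            F F-neg = sym -0#≈0#
    ∑-⊖ ((a , μ) ∷ Q) F F-neg = trans (+-cong (F-neg a μ) (∑-⊖ Q F F-neg)) (⁻¹-∙-comm _ _)

    module _ (λ₂ λ₃ Γ a : ℤ) (ν : Vec ℤ (suc r)) where
      open PairExponents i

      line : ℤ → Vec ℤ (suc r)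
      line e = mono2 i (λ₃ ℤ.+ e ℤ.- Γ) (λ₂ ℤ.+ a ℤ.- e)

      onLine : ℤ → Carrier
      onLine e = 𝟙 (≡-dec ℤ._≟_ (line e) ν)

      centre : ℤ
      centre = Γ ℤ.+ λ₂ ℤ.- λ₃ ℤ.+ a

      private
        onLine-at : ∀ {u x y} e → u ≡ mono2 i x y → x ≡ λ₃ ℤ.+ e ℤ.- Γ → y ≡ λ₂ ℤ.+ a ℤ.- e →
          𝟙 (≡-dec ℤ._≟_ u ν) ≈ onLine e
        onLine-at e P.refl P.refl P.refl = refl

        spread-line : ∀ c → lookup (line c) (posR i) ℤ.- lookup (line c) (posL i) ≡ centre ℤ.- c ℤ.- c
        spread-line c = P.trans (P.cong₂ ℤ._-_ (lookup-mono2-posR _ _) (lookup-mono2-posL _ _)) (lemma λ₂ λ₃ Γ a c)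
          where
          lemma : ∀ λ₂ λ₃ Γ a c → λ₂ ℤ.+ a ℤ.- c ℤ.- (λ₃ ℤ.+ c ℤ.- Γ) ≡ Γ ℤ.+ λ₂ ℤ.- λ₃ ℤ.+ a ℤ.- c ℤ.- c
          lemma = solve-∀

        atν : Term → Carrier
        atν t = proj₁ t * 𝟙 (≡-dec ℤ._≟_ (proj₂ t) ν)

        reflected : Term → Carrier
        reflected t = atν ((1# * proj₁ t) * 1# , zipWith ℤ._+_ (zipWith ℤ._+_ (multα i (+ n)) (proj₂ t)) 0ᵛ) + 0#

        scaled : Term → Carrier
        scaled t = atν (proj₁ t * 1# , zipWith ℤ._+_ (proj₂ t) 0ᵛ)
          + (atν (proj₁ t * (- (v * 1#)) , zipWith ℤ._+_ (proj₂ t) (zipWith ℤ._+_ 0ᵛ (multα i (+ n)))) + 0#)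

        -- The left-hand side is what scaled and reflected compute to on a single monomial.
        regroup : ∀ {w G G′ x₁ x₂ x₃ x₄ x₅ b₁ b₂ b₃ b₄ b₅ : Carrier} →
          x₁ ≈ b₁ → x₂ ≈ b₂ → x₃ ≈ b₃ → x₄ ≈ b₄ → x₅ ≈ b₅ → G′ ≈ G →
          ((w * 1#) * x₁ + ((w * (- (v * 1#))) * x₂ + 0#))
            + - ((((1# * (w * ((1# + - v) * 1#))) * 1#) * x₃ + 0#)
                + ((((1# * (w * (- ((v * G′) * (1# * 1#))))) * 1#) * x₄ + 0#)
                + ((((1# * (w * (- ((v * G′) * (1# * (- 1#)))))) * 1#) * x₅ + 0#) + 0#)))
          ≈ w * profile (v * G) b₁ b₂ b₃ b₄ b₅
        regroup {w} {G} {G′} {b₁ = b₁} {b₂} {b₃} {b₄} {b₅} e₁ e₂ e₃ e₄ e₅ eG =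
          trans (+-cong (+-cong (*-congˡ e₁) (+-congʳ (*-congˡ e₂)))
                        (-‿cong (+-cong (+-congʳ (*-congˡ e₃))
                                 (+-cong (+-congʳ (*-cong (*-congʳ (*-congˡ (*-congˡ (-‿cong (*-congʳ (*-congˡ eG)))))) e₄))
                                         (+-congʳ (+-congʳ (*-cong (*-congʳ (*-congˡ (*-congˡ (-‿cong (*-congʳ (*-congˡ eG)))))) e₅)))))))
            (solve 8 (λ w v G b₁ b₂ b₃ b₄ b₅ →
              (((w :* con (+ 1)) :* b₁) :+ (((w :* (:- (v :* con (+ 1)))) :* b₂) :+ con (+ 0)))
              :+ (:- (((((con (+ 1) :* (w :* ((con (+ 1) :+ (:- v)) :* con (+ 1)))) :* con (+ 1)) :* b₃) :+ con (+ 0))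
                      :+ (((((con (+ 1) :* (w :* (:- ((v :* G) :* (con (+ 1) :* con (+ 1)))))) :* con (+ 1)) :* b₄) :+ con (+ 0))
                      :+ (((((con (+ 1) :* (w :* (:- ((v :* G) :* (con (+ 1) :* (:- con (+ 1))))))) :* con (+ 1)) :* b₅) :+ con (+ 0)) :+ con (+ 0)))))
              := w :* (((b₁ :+ (:- (v :* b₂))) :+ (:- ((((con (+ 1) :+ (:- v)) :* b₃) :+ (:- ((v :* G) :* b₄))) :+ ((v :* G) :* b₅))))))
              refl w v G b₁ b₂ b₃ b₄ b₅)

        monomial-contribution : ∀ w c → scaled (w , line c) + - ∑ (σnumTerm i (w , line c)) reflected ≈ w * Ψ centre onLine c
        monomial-contribution w c = regroup
          (onLine-at c (zipWith-mono2 P.refl replicate-mono2) (ℤP.+-identityʳ _) (ℤP.+-identityʳ _))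
          (onLine-at (c ℤ.+ N) (zipWith-mono2 P.refl (zipWith-mono2 replicate-mono2 P.refl))
            (shift₁ λ₃ Γ c N) (shift₂ λ₂ a c N))
          (onLine-at (centre ℤ.- c ℤ.+ N ℤ.- + rₙ n (centre ℤ.- c ℤ.- c))
            (reflected-exponent (zipWith-mono2 replicate-mono2 P.refl))
            (P.trans (P.cong (λ d → N ℤ.+ (λ₂ ℤ.+ a ℤ.- c ℤ.+ (+ 0 ℤ.+ ℤ.- + rₙ n d)) ℤ.+ + 0) (spread-line c))
                     (reflect₁ λ₂ λ₃ Γ a c N (+ rₙ n (centre ℤ.- c ℤ.- c))))
            (P.trans (P.cong (λ d → ℤ.- N ℤ.+ (λ₃ ℤ.+ c ℤ.- Γ ℤ.+ (+ 0 ℤ.+ ℤ.- ℤ.- + rₙ n d)) ℤ.+ + 0) (spread-line c))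
                     (reflect₂ λ₂ λ₃ Γ a c N (+ rₙ n (centre ℤ.- c ℤ.- c)))))
          (onLine-at (centre ℤ.- c ℤ.+ + 1)
            (reflected-exponent (zipWith-mono2 replicate-mono2 (zipWith-mono2 P.refl replicate-mono2)))
            (reflect₃ λ₂ λ₃ Γ a c N) (reflect₄ λ₂ λ₃ Γ a c N))
          (onLine-at (centre ℤ.- c ℤ.+ + 1 ℤ.+ N)
            (reflected-exponent (zipWith-mono2 replicate-mono2 (zipWith-mono2 P.refl P.refl)))
            (reflect₅ λ₂ λ₃ Γ a c N) (reflect₆ λ₂ λ₃ Γ a c N))
          (reflexive (P.cong (λ d → g (+ 1 ℤ.+ d)) (spread-line c)))
          where
          N : ℤ
          N = + n
          reflected-exponent : ∀ {u x y} → u ≡ mono2 i x y →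
            zipWith ℤ._+_ (zipWith ℤ._+_ (multα i N) (zipWith ℤ._+_ (swapExp i (line c)) u)) 0ᵛ
              ≡ mono2 i (N ℤ.+ (λ₂ ℤ.+ a ℤ.- c ℤ.+ x) ℤ.+ + 0) (ℤ.- N ℤ.+ (λ₃ ℤ.+ c ℤ.- Γ ℤ.+ y) ℤ.+ + 0)
          reflected-exponent u≡ = zipWith-mono2 (zipWith-mono2 P.refl (zipWith-mono2 (swapExp-mono2 P.refl) u≡)) replicate-mono2
          shift₁ : ∀ λ₃ Γ c N → λ₃ ℤ.+ c ℤ.- Γ ℤ.+ (+ 0 ℤ.+ N) ≡ λ₃ ℤ.+ (c ℤ.+ N) ℤ.- Γ
          shift₁ = solve-∀
          shift₂ : ∀ λ₂ a c N → λ₂ ℤ.+ a ℤ.- c ℤ.+ (+ 0 ℤ.+ ℤ.- N) ≡ λ₂ ℤ.+ a ℤ.- (c ℤ.+ N)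
          shift₂ = solve-∀
          reflect₁ : ∀ λ₂ λ₃ Γ a c N ρ → N ℤ.+ (λ₂ ℤ.+ a ℤ.- c ℤ.+ (+ 0 ℤ.+ ℤ.- ρ)) ℤ.+ + 0
            ≡ λ₃ ℤ.+ (Γ ℤ.+ λ₂ ℤ.- λ₃ ℤ.+ a ℤ.- c ℤ.+ N ℤ.- ρ) ℤ.- Γ
          reflect₁ = solve-∀
          reflect₂ : ∀ λ₂ λ₃ Γ a c N ρ → ℤ.- N ℤ.+ (λ₃ ℤ.+ c ℤ.- Γ ℤ.+ (+ 0 ℤ.+ ℤ.- ℤ.- ρ)) ℤ.+ + 0
            ≡ λ₂ ℤ.+ a ℤ.- (Γ ℤ.+ λ₂ ℤ.- λ₃ ℤ.+ a ℤ.- c ℤ.+ N ℤ.- ρ)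
          reflect₂ = solve-∀
          reflect₃ : ∀ λ₂ λ₃ Γ a c N → N ℤ.+ (λ₂ ℤ.+ a ℤ.- c ℤ.+ (+ 0 ℤ.+ (+ 1 ℤ.- N ℤ.+ + 0))) ℤ.+ + 0
            ≡ λ₃ ℤ.+ (Γ ℤ.+ λ₂ ℤ.- λ₃ ℤ.+ a ℤ.- c ℤ.+ + 1) ℤ.- Γ
          reflect₃ = solve-∀
          reflect₄ : ∀ λ₂ λ₃ Γ a c N → ℤ.- N ℤ.+ (λ₃ ℤ.+ c ℤ.- Γ ℤ.+ (+ 0 ℤ.+ (ℤ.- (+ 1 ℤ.- N) ℤ.+ + 0))) ℤ.+ + 0
            ≡ λ₂ ℤ.+ a ℤ.- (Γ ℤ.+ λ₂ ℤ.- λ₃ ℤ.+ a ℤ.- c ℤ.+ + 1)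
          reflect₄ = solve-∀
          reflect₅ : ∀ λ₂ λ₃ Γ a c N → N ℤ.+ (λ₂ ℤ.+ a ℤ.- c ℤ.+ (+ 0 ℤ.+ (+ 1 ℤ.- N ℤ.+ N))) ℤ.+ + 0
            ≡ λ₃ ℤ.+ (Γ ℤ.+ λ₂ ℤ.- λ₃ ℤ.+ a ℤ.- c ℤ.+ + 1 ℤ.+ N) ℤ.- Γ
          reflect₅ = solve-∀
          reflect₆ : ∀ λ₂ λ₃ Γ a c N → ℤ.- N ℤ.+ (λ₃ ℤ.+ c ℤ.- Γ ℤ.+ (+ 0 ℤ.+ (ℤ.- (+ 1 ℤ.- N) ℤ.+ ℤ.- N))) ℤ.+ + 0
            ≡ λ₂ ℤ.+ a ℤ.- (Γ ℤ.+ λ₂ ℤ.- λ₃ ℤ.+ a ℤ.- c ℤ.+ + 1 ℤ.+ N)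
          reflect₆ = solve-∀

      coeff-𝒟-line : ∀ cs (W : ℤ → Carrier) →
        coeff (num (𝒟 i (map (λ c → (W c , line c)) cs))) ν ≈ ∑ cs (λ c → W c * Ψ centre onLine c)
      coeff-𝒟-line cs W = begin
        coeff (num (𝒟 i f)) ν                          ≈⟨ coeff-∑ (num (𝒟 i f)) ν ⟩
        ∑ ((f ⊗ D) ⊕ (⊖ Xσf)) atν                      ≈⟨ ∑-++ (f ⊗ D) (⊖ Xσf) atν ⟩
        ∑ (f ⊗ D) atν + ∑ (⊖ Xσf) atν                  ≈⟨ +-cong scaled-part (trans (∑-⊖ Xσf atν atν-neg) (-‿cong reflected-part)) ⟩
        ∑ cs (λ c → scaled (W c , line c)) + - ∑ cs (λ c → ∑ (σnumTerm i (W c , line c)) reflected)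
                                                       ≈⟨ trans (∑-+ cs _ _) (+-congˡ (∑-neg cs _)) ⟨
        ∑ cs (λ c → scaled (W c , line c) + - ∑ (σnumTerm i (W c , line c)) reflected)
                                                       ≈⟨ ∑-cong cs (λ c → monomial-contribution (W c) c) ⟩
        ∑ cs (λ c → W c * Ψ centre onLine c)           ∎
        where
        open import Relation.Binary.Reasoning.Setoid setoid
        f D Xσf : LP (suc r)
        f   = map (λ c → (W c , line c)) cs
        D   = constLP 1# ⊕ (⊖ (constLP v ⊗ xα i (+ n)))
        Xσf = (xα i (+ n) ⊗ concatMap (σnumTerm i) f) ⊗ constLP 1#
        atν-neg : ∀ a μ → atν (- a , μ) ≈ - atν (a , μ)
        atν-neg a μ = sym (-‿distribˡ-* a _)
        scaled-part : ∑ (f ⊗ D) atν ≈ ∑ cs (λ c → scaled (W c , line c))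
        scaled-part = trans (∑-⊗[1-vxα] (+ n) f atν) (∑-map _ cs scaled)
        reflected-part : ∑ Xσf atν ≈ ∑ cs (λ c → ∑ (σnumTerm i (W c , line c)) reflected)
        reflected-part = begin
          ∑ Xσf atν                                                    ≈⟨ ∑-⊗1 (xα i (+ n) ⊗ concatMap (σnumTerm i) f) atν ⟩
          ∑ (xα i (+ n) ⊗ concatMap (σnumTerm i) f) padded             ≈⟨ ∑-xα⊗ (+ n) (concatMap (σnumTerm i) f) padded ⟩
          ∑ (concatMap (σnumTerm i) f) reflected                       ≈⟨ ∑-concatMap (σnumTerm i) f reflected ⟩
          ∑ f (λ t → ∑ (σnumTerm i t) reflected)                       ≈⟨ ∑-map _ cs _ ⟩
          ∑ cs (λ c → ∑ (σnumTerm i (W c , line c)) reflected)         ∎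
          where
          padded : Term → Carrier
          padded t = atν (proj₁ t * 1# , zipWith ℤ._+_ (proj₂ t) 0ᵛ) + 0#

  Ψ-cong : ∀ s {β β′ : ℤ → Carrier} → (∀ e → β e ≡ β′ e) → ∀ c → Ψ s β c ≈ Ψ s β′ c
  Ψ-cong s β≡β′ c = profile-cong refl (reflexive (β≡β′ _)) (reflexive (β≡β′ _)) (reflexive (β≡β′ _))
    (reflexive (β≡β′ _)) (reflexive (β≡β′ _))

  Ψ-zero : ∀ s {β : ℤ → Carrier} → (∀ e → β e ≡ 0#) → ∀ c → Ψ s β c ≈ 0#
  Ψ-zero s β≡0 c = trans (Ψ-cong s β≡0 c)
    (solve 2 (λ v G → con (+ 0) :+ :- (v :* con (+ 0)) :+ :- ((con (+ 1) :+ :- v) :* con (+ 0) :+ :- (G :* con (+ 0)) :+ G :* con (+ 0))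
      := con (+ 0)) refl v (v * g (+ 1 ℤ.+ (s ℤ.- c ℤ.- c))))

module PointProfile {c ℓ : Level} (R : CommutativeRing c ℓ) (n : ℕ) .{{_ : NonZero n}}
  (v : CommutativeRing.Carrier R) (G : GaussSums R n v) where
  open CommutativeRing R
  open import Algebra.Properties.Ring ring using (-0#≈0#)
  open import Relation.Binary.Reasoning.Setoid setoid
  open GaussSums G
  open IntegerCoefficients R
  open Sums R
  open Residues n
  open Periodic setoid n g g-periodic
  open ChintaGunnells R
  open Action n v g
  open LineCoefficients R n v g

  u : Carrier
  u = 1# + - v

  h♭≈u𝟙 : ∀ t → h♭ t ≈ u * 𝟙 (+ n ∣? t)
  h♭≈u𝟙 t with rₙ n t ℕ.≟ 0 | + n ∣? t
  ... | yes _   | yes _   = sym (*-identityʳ _)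
  ... | yes r≡0 | no n∤t  = ⊥-elim (n∤t (rₙ≡0⇒∣ t r≡0))
  ... | no r≢0  | yes n∣t = ⊥-elim (r≢0 (∣⇒rₙ≡0 t n∣t))
  ... | no _    | no _    = sym (zeroʳ _)

  δ-below : ∀ {a t} → t ℤ.< a → δ a t ≡ 0#
  δ-below {a} {t} t<a with a ℤ.<? t | a ℤ.≟ t
  ... | yes a<t | _          = ⊥-elim (ℤP.<-asym a<t t<a)
  ... | no _    | yes P.refl = ⊥-elim (ℤP.<-irrefl P.refl t<a)
  ... | no _    | no _       = P.refl

  δ-at : ∀ a → δ a a ≡ - v
  δ-at a with a ℤ.<? a | a ℤ.≟ a
  ... | yes a<a | _      = ⊥-elim (ℤP.<-irrefl P.refl a<a)
  ... | no _    | yes _  = P.refl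
  ... | no _    | no a≢a = ⊥-elim (a≢a P.refl)

  δ-above : ∀ {a t} → a ℤ.< t → δ a t ≡ u
  δ-above {a} {t} a<t with a ℤ.<? t
  ... | yes _   = P.refl
  ... | no a≮t  = ⊥-elim (a≮t a<t)

  hB-below : ∀ {B t} → t ℤ.< B → hB B t ≡ h♭ t
  hB-below {B} {t} t<B with t ℤ.<? B
  ... | yes _  = P.refl
  ... | no t≮B = ⊥-elim (t≮B t<B)

  hB-at : ∀ B → hB B B ≡ g♭ B
  hB-at B with B ℤ.<? B
  ... | yes B<B = ⊥-elim (ℤP.<-irrefl P.refl B<B)
  ... | no _    = P.refl

  module Window (a : ℤ) (1≤a : + 1 ℤ.≤ a) (n∣a : + n ∣ a) (m : ℕ) (k : ℤ) where

    B N s : ℤ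
    B = + suc m
    N = + n
    s = B ℤ.- + 1 ℤ.+ a

    ρ : ℕ
    ρ = rₙ n (+ m)

    M : ℤ
    M = + m ℤ.- + ρ

    n∣M : + n ∣ M
    n∣M = n∣x-rₙx (+ m)

    M≤m : M ℤ.≤ + m
    M≤m = ℤP.i-j≤i (+ m) (+ ρ)

    m<M+N : + m ℤ.< M ℤ.+ N
    m<M+N = P.subst (ℤ._< M ℤ.+ N) (lemma (+ m) (+ ρ)) (ℤP.+-monoʳ-< M (ℤ.+<+ (rₙ<n (+ m))))
      where
      lemma : ∀ x r → x ℤ.- r ℤ.+ r ≡ x
      lemma = solve-∀

    multiple<M+N⇒≤M : ∀ {t} → + n ∣ t → t ℤ.< M ℤ.+ N → t ℤ.≤ M
    multiple<M+N⇒≤M {t} n∣t t<M+N with t ℤ.≤? M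
    ... | yes t≤M = t≤M
    ... | no t≰M  = ⊥-elim (ℤP.<⇒≱ t<M+N (multiples-gap n∣M n∣t (ℤP.≰⇒> t≰M)))

    multiple≤m⇒≤M : ∀ {t} → + n ∣ t → t ℤ.≤ + m → t ℤ.≤ M
    multiple≤m⇒≤M n∣t t≤m = multiple<M+N⇒≤M n∣t (ℤP.≤-<-trans t≤m m<M+N)

    w K J : ℤ → Carrier
    w t = δ a t * h♭ t
    K t = window m t * w t
    J t = 𝟙 (+ n ∣? t) * (𝟙 (a ℤ.≤? t) * 𝟙 (t ℤ.≤? M))

    gB : Carrier
    gB = v * g B

    S₁ S₂ : ℤ
    S₁ = M ℤ.+ a ℤ.+ N
    S₂ = B ℤ.+ a

    Φ : ℤ → Carrier
    Φ c = profile gB (point k c) (point (k ℤ.- N) c) (point (S₁ ℤ.- k) c) (point (S₂ ℤ.- k) c) (point (S₂ ℤ.+ N ℤ.- k) c)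

    Ψ-on-multiples : ∀ c → + n ∣ c → Ψ s (point k) c ≈ Φ c
    Ψ-on-multiples c n∣c = profile-cong
      (*-congˡ (g-resp-∣ (+ 1 ℤ.+ (s ℤ.- c ℤ.- c)) B (∣-resp-≡ a-2c (lemma₁ (+ m) a c))))
      refl
      (reflexive (𝟙-≟-by-difference (c ℤ.+ N) k c (k ℤ.- N) (lemma₂ c k N)))
      (reflexive (P.trans (𝟙-≟-sym E₁ k) (𝟙-≟-by-difference k E₁ c (S₁ ℤ.- k)
        (P.trans (P.cong (λ r → k ℤ.- (s ℤ.- c ℤ.+ N ℤ.- + r)) ρ-same) (lemma₃ (+ m) (+ ρ) a c k N)))))
      (reflexive (P.trans (𝟙-≟-sym (s ℤ.- c ℤ.+ + 1) k)
        (𝟙-≟-by-difference k (s ℤ.- c ℤ.+ + 1) c (S₂ ℤ.- k) (lemma₄ (+ m) a c k))))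
      (reflexive (P.trans (𝟙-≟-sym (s ℤ.- c ℤ.+ + 1 ℤ.+ N) k)
        (𝟙-≟-by-difference k (s ℤ.- c ℤ.+ + 1 ℤ.+ N) c (S₂ ℤ.+ N ℤ.- k) (lemma₅ (+ m) a c k N))))
      where
      E₁ : ℤ
      E₁ = s ℤ.- c ℤ.+ N ℤ.- + rₙ n (s ℤ.- c ℤ.- c)
      a-2c : + n ∣ a ℤ.- c ℤ.- c
      a-2c = ∣m∣n⇒∣m-n (∣m∣n⇒∣m-n n∣a n∣c) n∣c
      ρ-same : rₙ n (s ℤ.- c ℤ.- c) ≡ ρ
      ρ-same = rₙ-cong (s ℤ.- c ℤ.- c) (+ m) (∣-resp-≡ a-2c (lemma₆ (+ m) a c))
        where
        lemma₆ : ∀ m a c → a ℤ.- c ℤ.- c ≡ m ℤ.+ a ℤ.- c ℤ.- c ℤ.- m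
        lemma₆ = solve-∀
      lemma₁ : ∀ m a c → a ℤ.- c ℤ.- c ≡ + 1 ℤ.+ (m ℤ.+ a ℤ.- c ℤ.- c) ℤ.- (+ 1 ℤ.+ m)
      lemma₁ = solve-∀
      lemma₂ : ∀ c k N → c ℤ.+ N ℤ.- k ≡ c ℤ.- (k ℤ.- N)
      lemma₂ = solve-∀
      lemma₃ : ∀ m r a c k N → k ℤ.- (m ℤ.+ a ℤ.- c ℤ.+ N ℤ.- r) ≡ c ℤ.- (m ℤ.- r ℤ.+ a ℤ.+ N ℤ.- k)
      lemma₃ = solve-∀
      lemma₄ : ∀ m a c k → k ℤ.- (m ℤ.+ a ℤ.- c ℤ.+ + 1) ≡ c ℤ.- (+ 1 ℤ.+ m ℤ.+ a ℤ.- k)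
      lemma₄ = solve-∀
      lemma₅ : ∀ m a c k N → k ℤ.- (m ℤ.+ a ℤ.- c ℤ.+ + 1 ℤ.+ N) ≡ c ℤ.- (+ 1 ℤ.+ m ℤ.+ a ℤ.+ N ℤ.- k)
      lemma₅ = solve-∀

    bulk-term : ∀ c → c ℤ.< B → (δ a c * hB B c) * Ψ s (point k) c ≈ w c * Φ c
    bulk-term c c<B with + n ∣? c
    ... | yes n∣c = *-cong (*-congˡ (reflexive (hB-below c<B))) (Ψ-on-multiples c n∣c)
    ... | no n∤c  = trans (*-congʳ (trans (*-congˡ (reflexive (hB-below c<B))) w≈0))
                          (trans (zeroˡ _) (sym (trans (*-congʳ w≈0) (zeroˡ _))))
      where
      w≈0 : w c ≈ 0#
      w≈0 = trans (*-congˡ (trans (h♭≈u𝟙 c) (trans (*-congˡ (reflexive (𝟙-no n∤c (+ n ∣? c)))) (zeroʳ u)))) (zeroʳ _)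

    ∑-point : ∀ x t → ∑ (range1 (+ m)) (λ c → x * (w c * point t c)) ≈ x * K t
    ∑-point x t = trans (∑-*ˡ (range1 (+ m)) x _) (*-congˡ (∑-range1-point m w t))

    bulk-sum : ∑ (range1 (+ m)) (λ c → w c * Φ c)
      ≈ 1# * K k + (- v * K (k ℤ.- N) + (- u * K (S₁ ℤ.- k) + (gB * K (S₂ ℤ.- k) + - gB * K (S₂ ℤ.+ N ℤ.- k))))
    bulk-sum = trans (∑-cong cs expand)
      (trans (∑-+ cs _ _) (+-cong (∑-point 1# k)
      (trans (∑-+ cs _ _) (+-cong (∑-point (- v) (k ℤ.- N))
      (trans (∑-+ cs _ _) (+-cong (∑-point (- u) (S₁ ℤ.- k))
      (trans (∑-+ cs _ _) (+-cong (∑-point gB (S₂ ℤ.- k)) (∑-point (- gB) (S₂ ℤ.+ N ℤ.- k))))))))))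
      where
      cs : List ℤ
      cs = range1 (+ m)
      expand : ∀ c → w c * Φ c ≈ 1# * (w c * point k c) + (- v * (w c * point (k ℤ.- N) c)
        + (- u * (w c * point (S₁ ℤ.- k) c) + (gB * (w c * point (S₂ ℤ.- k) c) + - gB * (w c * point (S₂ ℤ.+ N ℤ.- k) c))))
      expand c = solve 8 (λ w v G x₁ x₂ x₃ x₄ x₅ →
        w :* ((x₁ :+ :- (v :* x₂)) :+ :- (((con (+ 1) :+ :- v) :* x₃ :+ :- (G :* x₄)) :+ G :* x₅))
        := con (+ 1) :* (w :* x₁) :+ (:- v :* (w :* x₂) :+ (:- (con (+ 1) :+ :- v) :* (w :* x₃)
           :+ (G :* (w :* x₄) :+ :- G :* (w :* x₅)))))
        refl (w c) v gB (point k c) (point (k ℤ.- N) c) (point (S₁ ℤ.- k) c) (point (S₂ ℤ.- k) c) (point (S₂ ℤ.+ N ℤ.- k) c)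

    K-vanishes : B ℤ.≤ a → ∀ t → K t ≈ 0#
    K-vanishes B≤a t with t ℤ.<? a
    ... | yes t<a = trans (*-congˡ (trans (*-congʳ (reflexive (δ-below t<a))) (zeroˡ _))) (zeroʳ _)
    ... | no t≮a  = trans (*-congʳ (trans (*-congˡ (reflexive (𝟙-no t≰m (t ℤ.≤? + m)))) (zeroʳ _))) (zeroˡ _)
      where
      t≰m : ¬ (t ℤ.≤ + m)
      t≰m t≤m = ℤP.<⇒≱ (ℤ.+<+ (ℕP.n<1+n m)) (ℤP.≤-trans B≤a (ℤP.≤-trans (ℤP.≮⇒≥ t≮a) t≤m))

    K≈J : a ℤ.< B → ∀ t → K t ≈ u * (u * J t + - point a t)
    K≈J a<B t = trans (*-congˡ (*-congˡ (h♭≈u𝟙 t))) (by-position (ℤP.<-cmp t a))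
      where
      a≤m : a ℤ.≤ + m
      a≤m = ℤP.i<j⇒i≤pred[j] a<B
      by-position : Tri (t ℤ.< a) (t ≡ a) (a ℤ.< t) →
        window m t * (δ a t * (u * 𝟙 (+ n ∣? t))) ≈ u * (u * J t + - point a t)
      by-position (tri< t<a _ _)
        rewrite δ-below t<a | 𝟙-no (ℤP.<⇒≱ t<a) (a ℤ.≤? t) | 𝟙-no (ℤP.<⇒≢ t<a) (t ℤ.≟ a) =
        solve 4 (λ W u D L → W :* (con (+ 0) :* (u :* D)) := u :* (u :* (D :* (con (+ 0) :* L)) :+ :- con (+ 0)))
          refl (window m t) u (𝟙 (+ n ∣? t)) (𝟙 (t ℤ.≤? M))
      by-position (tri≈ _ P.refl _)
        rewrite δ-at a | 𝟙-yes n∣a (+ n ∣? a) | 𝟙-yes ℤP.≤-refl (a ℤ.≤? a) | 𝟙-yes (multiple≤m⇒≤M n∣a a≤m) (a ℤ.≤? M)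
              | 𝟙-yes P.refl (a ℤ.≟ a) | 𝟙-yes 1≤a (+ 1 ℤ.≤? a) | 𝟙-yes a≤m (a ℤ.≤? + m) =
        solve 1 (λ v → (con (+ 1) :* con (+ 1)) :* (:- v :* ((con (+ 1) :+ :- v) :* con (+ 1)))
          := (con (+ 1) :+ :- v) :* ((con (+ 1) :+ :- v) :* (con (+ 1) :* (con (+ 1) :* con (+ 1))) :+ :- con (+ 1))) refl v
      by-position (tri> _ _ a<t)
        rewrite δ-above a<t | 𝟙-yes (ℤP.<⇒≤ a<t) (a ℤ.≤? t) | 𝟙-no (ℤP.<⇒≢ a<t ∘ P.sym) (t ℤ.≟ a)
              | 𝟙-yes (ℤP.≤-trans 1≤a (ℤP.<⇒≤ a<t)) (+ 1 ℤ.≤? t) = by-divisibility (+ n ∣? t)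
        where
        by-divisibility : (d : Dec (+ n ∣ t)) →
          (1# * 𝟙 (t ℤ.≤? + m)) * (u * (u * 𝟙 d)) ≈ u * (u * (𝟙 d * (1# * 𝟙 (t ℤ.≤? M))) + - 0#)
        by-divisibility (yes n∣t)
          rewrite 𝟙-⇔ (multiple≤m⇒≤M n∣t) (λ t≤M → ℤP.≤-trans t≤M M≤m) (t ℤ.≤? + m) (t ℤ.≤? M) =
          solve 2 (λ L u → (con (+ 1) :* L) :* (u :* (u :* con (+ 1))) := u :* (u :* (con (+ 1) :* (con (+ 1) :* L)) :+ :- con (+ 0)))
            refl (𝟙 (t ℤ.≤? M)) u
        by-divisibility (no _) =
          solve 3 (λ W L u → (con (+ 1) :* W) :* (u :* (u :* con (+ 0))) := u :* (u :* (con (+ 0) :* (con (+ 1) :* L)) :+ :- con (+ 0)))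
            refl (𝟙 (t ℤ.≤? + m)) (𝟙 (t ℤ.≤? M)) u

    J-vanishes : ∀ {t} → ¬ (+ n ∣ t × a ℤ.≤ t × t ℤ.≤ M) → J t ≈ 0#
    J-vanishes {t} ¬J with + n ∣? t | a ℤ.≤? t | t ℤ.≤? M
    ... | yes n∣t | yes a≤t | yes t≤M = ⊥-elim (¬J (n∣t , a≤t , t≤M))
    ... | yes _   | yes _   | no _    = trans (*-congˡ (zeroʳ 1#)) (zeroʳ 1#)
    ... | yes _   | no _    | _       = trans (*-congˡ (zeroˡ _)) (zeroʳ 1#)
    ... | no _    | _       | _       = zeroˡ _

    J-one : ∀ {t} → + n ∣ t → a ℤ.≤ t → t ℤ.≤ M → J t ≈ 1#
    J-one {t} n∣t a≤t t≤M
      rewrite 𝟙-yes n∣t (+ n ∣? t) | 𝟙-yes a≤t (a ℤ.≤? t) | 𝟙-yes t≤M (t ℤ.≤? M) = trans (*-identityˡ _) (*-identityˡ _)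

    a≤M : a ℤ.< B → a ℤ.≤ M
    a≤M a<B = multiple≤m⇒≤M n∣a (ℤP.i<j⇒i≤pred[j] a<B)

    x+N-N≡x : ∀ x → x ℤ.+ N ℤ.- N ≡ x
    x+N-N≡x x = lemma x N
      where
      lemma : ∀ x N → x ℤ.+ N ℤ.- N ≡ x
      lemma = solve-∀

    x-N+N≡x : ∀ x → x ℤ.- N ℤ.+ N ≡ x
    x-N+N≡x x = lemma x N
      where
      lemma : ∀ x N → x ℤ.- N ℤ.+ N ≡ x
      lemma = solve-∀

    t-N<t : ∀ t → t ℤ.- N ℤ.< t
    t-N<t t = P.subst (t ℤ.- N ℤ.<_) (x-N+N≡x t) (x<x+n (t ℤ.- N))

    a≤t-N : ∀ {t} → a ℤ.< t → + n ∣ t → a ℤ.≤ t ℤ.- N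
    a≤t-N {t} a<t n∣t = P.subst (ℤ._≤ t ℤ.- N) (x+N-N≡x a) (ℤP.+-monoˡ-≤ (ℤ.- N) (multiples-gap n∣a n∣t a<t))

    private
      close : ∀ {t x y x′ y′} → J t ≈ x → J (t ℤ.- N) ≈ y → point a t ≡ x′ → point (M ℤ.+ N) t ≡ y′ →
        x + - y ≈ x′ + - y′ → J t + - J (t ℤ.- N) ≈ point a t + - point (M ℤ.+ N) t
      close Jt Jt-N P.refl P.refl e = trans (+-cong Jt (-‿cong Jt-N)) e

    J-shift-inside : ∀ {t} → a ℤ.< t → t ℤ.< M ℤ.+ N → J t ≈ J (t ℤ.- N)
    J-shift-inside {t} a<t t<M+N = by-divisibility (+ n ∣? t)
      where
      by-divisibility : Dec (+ n ∣ t) → J t ≈ J (t ℤ.- N)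
      by-divisibility (yes n∣t) = trans (J-one n∣t (ℤP.<⇒≤ a<t) (multiple<M+N⇒≤M n∣t t<M+N))
        (sym (J-one (∣m∣n⇒∣m-n n∣t ∣-refl) (a≤t-N a<t n∣t) (ℤP.≤-trans (ℤP.<⇒≤ (t-N<t t)) (multiple<M+N⇒≤M n∣t t<M+N))))
      by-divisibility (no n∤t) = trans (J-vanishes (n∤t ∘ proj₁)) (sym (J-vanishes (n∤t ∘ n∣t-N⇒n∣t ∘ proj₁)))
        where
        n∣t-N⇒n∣t : + n ∣ t ℤ.- N → + n ∣ t
        n∣t-N⇒n∣t n∣t-N = ∣-resp-≡ (∣m∣n⇒∣m+n n∣t-N ∣-refl) (x-N+N≡x t)

    J-telescopes : a ℤ.< B → ∀ t → J t + - J (t ℤ.- N) ≈ point a t + - point (M ℤ.+ N) t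
    J-telescopes a<B t with ℤP.<-cmp t a
    ... | tri< t<a _ _ = close (J-vanishes (λ (_ , a≤t , _) → ℤP.<⇒≱ t<a a≤t))
                                (J-vanishes (λ (_ , a≤t-N , _) → ℤP.<⇒≱ (ℤP.<-trans (t-N<t t) t<a) a≤t-N))
                                (𝟙-no (ℤP.<⇒≢ t<a) (t ℤ.≟ a))
                                (𝟙-no (ℤP.<⇒≢ (ℤP.<-≤-trans t<a (ℤP.≤-trans (a≤M a<B) (ℤP.<⇒≤ (x<x+n M))))) (t ℤ.≟ M ℤ.+ N))
                                refl
    ... | tri≈ _ P.refl _ = close (J-one n∣a ℤP.≤-refl (a≤M a<B))
                                (J-vanishes (λ (_ , a≤a-N , _) → ℤP.<⇒≱ (t-N<t a) a≤a-N))
                                (𝟙-yes P.refl (a ℤ.≟ a))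
                                (𝟙-no (ℤP.<⇒≢ (ℤP.≤-<-trans (a≤M a<B) (x<x+n M))) (a ℤ.≟ M ℤ.+ N))
                                refl
    ... | tri> _ _ a<t with ℤP.<-cmp t (M ℤ.+ N)
    ...   | tri< t<M+N _ _ = close (J-shift-inside a<t t<M+N) refl
                                (𝟙-no (ℤP.<⇒≢ a<t ∘ P.sym) (t ℤ.≟ a))
                                (𝟙-no (ℤP.<⇒≢ t<M+N) (t ℤ.≟ M ℤ.+ N))
                                (trans (-‿inverseʳ _) (sym (trans (+-congˡ -0#≈0#) (+-identityʳ 0#))))
    ...   | tri≈ _ P.refl _ = close (J-vanishes (λ (_ , _ , M+N≤M) → ℤP.<⇒≱ (x<x+n M) M+N≤M))
                                (J-one (∣m∣n⇒∣m-n (∣m∣n⇒∣m+n n∣M ∣-refl) ∣-refl) (a≤t-N a<t (∣m∣n⇒∣m+n n∣M ∣-refl))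
                                       (ℤP.≤-reflexive (x+N-N≡x M)))
                                (𝟙-no (ℤP.<⇒≢ a<t ∘ P.sym) (M ℤ.+ N ℤ.≟ a))
                                (𝟙-yes P.refl (M ℤ.+ N ℤ.≟ M ℤ.+ N))
                                refl
    ...   | tri> _ _ M+N<t = close (J-vanishes (λ (_ , _ , t≤M) → ℤP.<⇒≱ (ℤP.<-trans (x<x+n M) M+N<t) t≤M))
                                (J-vanishes (λ (_ , _ , t-N≤M) → ℤP.<⇒≱ M<t-N t-N≤M))
                                (𝟙-no (ℤP.<⇒≢ a<t ∘ P.sym) (t ℤ.≟ a))
                                (𝟙-no (ℤP.<⇒≢ M+N<t ∘ P.sym) (t ℤ.≟ M ℤ.+ N))
                                refl
      where
      M<t-N : M ℤ.< t ℤ.- N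
      M<t-N = P.subst (ℤ._< t ℤ.- N) (x+N-N≡x M) (ℤP.+-monoˡ-< (ℤ.- N) M+N<t)

    J-reflects : ∀ t → J (M ℤ.+ a ℤ.- t) ≈ J t
    J-reflects t = trans (*-cong (reflexive divisible) (*-cong (reflexive lower) (reflexive upper))) (*-congˡ (*-comm _ _))
      where
      reflect-twice : ∀ M a t → M ℤ.+ a ℤ.- (M ℤ.+ a ℤ.- t) ≡ t
      reflect-twice = solve-∀
      reflect-a : ∀ M a → M ℤ.+ a ℤ.- a ≡ M
      reflect-a = solve-∀
      reflect-M : ∀ M a → M ℤ.+ a ℤ.- M ≡ a
      reflect-M = solve-∀
      divisible : 𝟙 (+ n ∣? M ℤ.+ a ℤ.- t) ≡ 𝟙 (+ n ∣? t)
      divisible = 𝟙-⇔ (λ n∣x → ∣-resp-≡ (∣m∣n⇒∣m-n (∣m∣n⇒∣m+n n∣M n∣a) n∣x) (reflect-twice M a t))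
                      (∣m∣n⇒∣m-n (∣m∣n⇒∣m+n n∣M n∣a)) (+ n ∣? M ℤ.+ a ℤ.- t) (+ n ∣? t)
      lower : 𝟙 (a ℤ.≤? M ℤ.+ a ℤ.- t) ≡ 𝟙 (t ℤ.≤? M)
      lower = 𝟙-⇔ (λ a≤ → P.subst₂ ℤ._≤_ (reflect-twice M a t) (reflect-a M a) (reflect-≤ (M ℤ.+ a) a≤))
                  (λ t≤M → P.subst (ℤ._≤ M ℤ.+ a ℤ.- t) (reflect-M M a) (reflect-≤ (M ℤ.+ a) t≤M))
                  (a ℤ.≤? M ℤ.+ a ℤ.- t) (t ℤ.≤? M)
      upper : 𝟙 (M ℤ.+ a ℤ.- t ℤ.≤? M) ≡ 𝟙 (a ℤ.≤? t)
      upper = 𝟙-⇔ (λ ≤M → P.subst₂ ℤ._≤_ (reflect-M M a) (reflect-twice M a t) (reflect-≤ (M ℤ.+ a) ≤M))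
                  (λ a≤t → P.subst (M ℤ.+ a ℤ.- t ℤ.≤_) (reflect-a M a) (reflect-≤ (M ℤ.+ a) a≤t))
                  (M ℤ.+ a ℤ.- t ℤ.≤? M) (a ℤ.≤? t)

    Δ E : ℤ
    Δ = B ℤ.- M
    E = s ℤ.- B ℤ.+ N ℤ.- + rₙ n (s ℤ.- B ℤ.- B)

    private
      n∸1<n : n ℕ.∸ 1 ℕ.< n
      n∸1<n = ℕP.∸-monoʳ-< {n} {1} {0} (ℕ.s≤s ℕ.z≤n) (ℕ.>-nonZero⁻¹ n)

      N-1 : + (n ℕ.∸ 1) ≡ N ℤ.- + 1
      N-1 = pos-∸ (ℕ.>-nonZero⁻¹ n)

    Δ-when-n∣B : + n ∣ B → Δ ≡ N
    Δ-when-n∣B n∣B = P.trans (lemma₁ B (+ ρ)) (P.trans (P.cong (λ r → + 1 ℤ.+ + r) ρ≡n-1) (P.trans (P.cong (λ x → + 1 ℤ.+ x) N-1) (lemma₂ N)))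
      where
      lemma₀ : ∀ B N → B ℤ.- N ≡ B ℤ.- + 1 ℤ.- (N ℤ.- + 1)
      lemma₀ = solve-∀
      ρ≡n-1 : ρ ≡ n ℕ.∸ 1
      ρ≡n-1 = rₙ-unique (+ m) (n ℕ.∸ 1) n∸1<n
        (∣-resp-≡ (∣m∣n⇒∣m-n n∣B ∣-refl) (P.trans (lemma₀ B N) (P.cong (λ x → + m ℤ.- x) (P.sym N-1))))
      lemma₁ : ∀ B r → B ℤ.- (B ℤ.- + 1 ℤ.- r) ≡ + 1 ℤ.+ r
      lemma₁ = solve-∀
      lemma₂ : ∀ N → + 1 ℤ.+ (N ℤ.- + 1) ≡ N
      lemma₂ = solve-∀

    E-when-n∣B : + n ∣ B → E ≡ a
    E-when-n∣B n∣B = P.trans (P.cong (λ r → s ℤ.- B ℤ.+ N ℤ.- + r) r≡n-1) (P.trans (P.cong (λ x → s ℤ.- B ℤ.+ N ℤ.- x) N-1) (lemma₂ B a N))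
      where
      lemma₁ : ∀ B a N → a ℤ.- B ℤ.- N ≡ B ℤ.- + 1 ℤ.+ a ℤ.- B ℤ.- B ℤ.- (N ℤ.- + 1)
      lemma₁ = solve-∀
      lemma₂ : ∀ B a N → B ℤ.- + 1 ℤ.+ a ℤ.- B ℤ.+ N ℤ.- (N ℤ.- + 1) ≡ a
      lemma₂ = solve-∀
      r≡n-1 : rₙ n (s ℤ.- B ℤ.- B) ≡ n ℕ.∸ 1
      r≡n-1 = rₙ-unique (s ℤ.- B ℤ.- B) (n ℕ.∸ 1) n∸1<n
        (∣-resp-≡ (∣m∣n⇒∣m-n (∣m∣n⇒∣m-n n∣a n∣B) ∣-refl)
                  (P.trans (lemma₁ B a N) (P.cong (λ x → s ℤ.- B ℤ.- B ℤ.- x) (P.sym N-1))))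

    E-when-n∤B : ¬ (+ n ∣ B) → E ≡ a ℤ.+ Δ
    E-when-n∤B n∤B = P.trans (P.cong (λ r → s ℤ.- B ℤ.+ N ℤ.- + r) r≡n-2-ρ)
      (P.trans (P.cong (λ x → s ℤ.- B ℤ.+ N ℤ.- x) (pos-∸ 2+ρ≤n)) (lemma₂ B a N (+ ρ)))
      where
      1+ρ≢n : suc ρ ≢ n
      1+ρ≢n 1+ρ≡n = n∤B (∣-resp-≡ (∣m∣n⇒∣m+n n∣M (P.subst (λ x → + n ∣ + x) (P.sym 1+ρ≡n) ∣-refl)) (lemma₀ B (+ ρ)))
        where
        lemma₀ : ∀ B r → B ℤ.- + 1 ℤ.- r ℤ.+ (+ 1 ℤ.+ r) ≡ B
        lemma₀ = solve-∀
      2+ρ≤n : 2 ℕ.+ ρ ℕ.≤ n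
      2+ρ≤n = ℕP.≤∧≢⇒< (rₙ<n (+ m)) 1+ρ≢n
      lemma₁ : ∀ B a N r → a ℤ.- N ℤ.- (B ℤ.- + 1 ℤ.- r) ≡ B ℤ.- + 1 ℤ.+ a ℤ.- B ℤ.- B ℤ.- (N ℤ.- (+ 2 ℤ.+ r))
      lemma₁ = solve-∀
      lemma₂ : ∀ B a N r → B ℤ.- + 1 ℤ.+ a ℤ.- B ℤ.+ N ℤ.- (N ℤ.- (+ 2 ℤ.+ r)) ≡ a ℤ.+ (B ℤ.- (B ℤ.- + 1 ℤ.- r))
      lemma₂ = solve-∀
      r≡n-2-ρ : rₙ n (s ℤ.- B ℤ.- B) ≡ n ℕ.∸ (2 ℕ.+ ρ)
      r≡n-2-ρ = rₙ-unique (s ℤ.- B ℤ.- B) (n ℕ.∸ (2 ℕ.+ ρ)) (ℕP.∸-monoʳ-< {n} {2 ℕ.+ ρ} {0} (ℕ.s≤s ℕ.z≤n) 2+ρ≤n)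
        (∣-resp-≡ (∣m∣n⇒∣m-n (∣m∣n⇒∣m-n n∣a ∣-refl) n∣M)
                  (P.trans (lemma₁ B a N (+ ρ)) (P.cong (λ x → s ℤ.- B ℤ.- B ℤ.- x) (P.sym (pos-∸ 2+ρ≤n)))))

    g′ : Carrier
    g′ = g (a ℤ.- B)

    last-term : (δ a B * hB B B) * Ψ s (point k) B
      ≈ (δ a B * gB) * profile (v * g′) (point B k) (point (B ℤ.+ N) k) (point E k) (point a k) (point (a ℤ.+ N) k)
    last-term = *-cong (*-congˡ (reflexive (hB-at B)))
      (profile-cong (*-congˡ (reflexive (P.cong g (lemma₁ B a))))
        (reflexive (𝟙-≟-sym B k)) (reflexive (𝟙-≟-sym (B ℤ.+ N) k)) (reflexive (𝟙-≟-sym E k))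
        (reflexive (P.trans (𝟙-≟-sym (s ℤ.- B ℤ.+ + 1) k) (P.cong (λ x → 𝟙 (k ℤ.≟ x)) (lemma₂ B a))))
        (reflexive (P.trans (𝟙-≟-sym (s ℤ.- B ℤ.+ + 1 ℤ.+ N) k) (P.cong (λ x → 𝟙 (k ℤ.≟ x)) (lemma₃ B a N)))))
      where
      lemma₁ : ∀ B a → + 1 ℤ.+ (B ℤ.- + 1 ℤ.+ a ℤ.- B ℤ.- B) ≡ a ℤ.- B
      lemma₁ = solve-∀
      lemma₂ : ∀ B a → B ℤ.- + 1 ℤ.+ a ℤ.- B ℤ.+ + 1 ≡ a
      lemma₂ = solve-∀
      lemma₃ : ∀ B a N → B ℤ.- + 1 ℤ.+ a ℤ.- B ℤ.+ + 1 ℤ.+ N ≡ a ℤ.+ N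
      lemma₃ = solve-∀

    total bulk last : Carrier
    total = ∑ (range1 B) (λ c → (δ a c * hB B c) * Ψ s (point k) c)
    bulk  = 1# * K k + (- v * K (k ℤ.- N) + (- u * K (S₁ ℤ.- k) + (gB * K (S₂ ℤ.- k) + - gB * K (S₂ ℤ.+ N ℤ.- k))))
    last  = (δ a B * gB) * profile (v * g′) (point B k) (point (B ℤ.+ N) k) (point E k) (point a k) (point (a ℤ.+ N) k)

    total-split : total ≈ bulk + last
    total-split = begin
      total                                      ≡⟨ P.cong (λ cs → ∑ cs F) (range1-suc m) ⟩
      ∑ (range1 (+ m) ++ [ B ]) F                ≈⟨ ∑-++ (range1 (+ m)) [ B ] F ⟩
      ∑ (range1 (+ m)) F + (F B + 0#)            ≈⟨ +-cong (trans (∑-cong-∈ (range1 (+ m)) (bulk-term _ ∘ below-B)) bulk-sum)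
                                                           (trans (+-identityʳ _) last-term) ⟩
      bulk + last                                ∎
      where
      F : ℤ → Carrier
      F c = (δ a c * hB B c) * Ψ s (point k) c
      below-B : ∀ {c} → c ∈ range1 (+ m) → c ℤ.< B
      below-B c∈ = ℤP.≤-<-trans (proj₂ (∈-range1 c∈)) (ℤ.+<+ (ℕP.n<1+n m))

    closed : (G G′ pΔ pE : Carrier) → Carrier
    closed G G′ pΔ pE = u * (u * (v * G) * (pΔ + - pE) + v * ((v * G) * G′ + - 1#) * (point a k + - point (a ℤ.+ N) k))

    closed-cong : ∀ {G G₂ G′ G′₂ pΔ pΔ₂ pE pE₂} → G ≈ G₂ → G′ ≈ G′₂ → pΔ ≈ pΔ₂ → pE ≈ pE₂ →
      closed G G′ pΔ pE ≈ closed G₂ G′₂ pΔ₂ pE₂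
    closed-cong eG eG′ eΔ eE = *-congˡ (+-cong (*-cong (*-congˡ (*-congˡ eG)) (+-cong eΔ (-‿cong eE)))
                                              (*-congʳ (*-congˡ (+-congʳ (*-cong (*-congˡ eG) eG′)))))

    K-at : a ℤ.< B → ∀ t {X y} → point a t ≡ point X k → J t ≈ J y → K t ≈ u * (u * J y + - point X k)
    K-at a<B t pt≡ Jt≈ = trans (K≈J a<B t) (*-congˡ (+-cong (*-congˡ Jt≈) (-‿cong (reflexive pt≡))))

    bulk-in-J : a ℤ.< B → bulk ≈ 1# * (u * (u * J k + - point a k))
      + (- v * (u * (u * J (k ℤ.- N) + - point (a ℤ.+ N) k))
      + (- u * (u * (u * J (k ℤ.- N) + - point (M ℤ.+ N) k))
      + (gB * (u * (u * J (k ℤ.- Δ) + - point B k))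
      + - gB * (u * (u * J (k ℤ.- Δ ℤ.- N) + - point (B ℤ.+ N) k)))))
    bulk-in-J a<B = +-cong (*-congˡ (K≈J a<B k))
      (+-cong (*-congˡ (K-at a<B (k ℤ.- N) (𝟙-≟-by-difference (k ℤ.- N) a k (a ℤ.+ N) (lemma₁ k N a)) refl))
      (+-cong (*-congˡ (K-at a<B (S₁ ℤ.- k)
                (P.trans (𝟙-≟-by-difference (S₁ ℤ.- k) a (M ℤ.+ N) k (lemma₂ M a N k)) (𝟙-≟-sym (M ℤ.+ N) k))
                (trans (reflexive (P.cong J (lemma₃ M a N k))) (J-reflects (k ℤ.- N)))))
      (+-cong (*-congˡ (K-at a<B (S₂ ℤ.- k)
                (P.trans (𝟙-≟-by-difference (S₂ ℤ.- k) a B k (lemma₄ B a k)) (𝟙-≟-sym B k))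
                (trans (reflexive (P.cong J (lemma₅ B M a k))) (J-reflects (k ℤ.- Δ)))))
              (*-congˡ (K-at a<B (S₂ ℤ.+ N ℤ.- k)
                (P.trans (𝟙-≟-by-difference (S₂ ℤ.+ N ℤ.- k) a (B ℤ.+ N) k (lemma₆ B a N k)) (𝟙-≟-sym (B ℤ.+ N) k))
                (trans (reflexive (P.cong J (lemma₇ B M a N k))) (J-reflects (k ℤ.- Δ ℤ.- N))))))))
      where
      lemma₁ : ∀ k N a → k ℤ.- N ℤ.- a ≡ k ℤ.- (a ℤ.+ N)
      lemma₁ = solve-∀
      lemma₂ : ∀ M a N k → M ℤ.+ a ℤ.+ N ℤ.- k ℤ.- a ≡ M ℤ.+ N ℤ.- k
      lemma₂ = solve-∀
      lemma₃ : ∀ M a N k → M ℤ.+ a ℤ.+ N ℤ.- k ≡ M ℤ.+ a ℤ.- (k ℤ.- N)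
      lemma₃ = solve-∀
      lemma₄ : ∀ B a k → B ℤ.+ a ℤ.- k ℤ.- a ≡ B ℤ.- k
      lemma₄ = solve-∀
      lemma₅ : ∀ B M a k → B ℤ.+ a ℤ.- k ≡ M ℤ.+ a ℤ.- (k ℤ.- (B ℤ.- M))
      lemma₅ = solve-∀
      lemma₆ : ∀ B a N k → B ℤ.+ a ℤ.+ N ℤ.- k ℤ.- a ≡ B ℤ.+ N ℤ.- k
      lemma₆ = solve-∀
      lemma₇ : ∀ B M a N k → B ℤ.+ a ℤ.+ N ℤ.- k ≡ M ℤ.+ a ℤ.- (k ℤ.- (B ℤ.- M) ℤ.- N)
      lemma₇ = solve-∀

    telescope-at-k : a ℤ.< B → J k + - J (k ℤ.- N) + - (point a k + - point (M ℤ.+ N) k) ≈ 0#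
    telescope-at-k a<B = trans (+-congʳ (J-telescopes a<B k)) (-‿inverseʳ _)

    telescope-at-k-Δ : a ℤ.< B → J (k ℤ.- Δ) + - J (k ℤ.- Δ ℤ.- N) + - (point (a ℤ.+ Δ) k + - point (B ℤ.+ N) k) ≈ 0#
    telescope-at-k-Δ a<B = trans (+-congʳ (trans (J-telescopes a<B (k ℤ.- Δ))
      (+-cong (reflexive (𝟙-≟-by-difference (k ℤ.- Δ) a k (a ℤ.+ Δ) (lemma₁ k Δ a)))
              (-‿cong (reflexive (𝟙-≟-by-difference (k ℤ.- Δ) (M ℤ.+ N) k (B ℤ.+ N) (lemma₂ k B M N)))))))
      (-‿inverseʳ _)
      where
      lemma₁ : ∀ k Δ a → k ℤ.- Δ ℤ.- a ≡ k ℤ.- (a ℤ.+ Δ)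
      lemma₁ = solve-∀
      lemma₂ : ∀ k B M N → k ℤ.- (B ℤ.- M) ℤ.- (M ℤ.+ N) ≡ k ℤ.- (B ℤ.+ N)
      lemma₂ = solve-∀

    closed-form : a ℤ.< B → total ≈ closed (g B) g′ (point (a ℤ.+ Δ) k) (point E k)
    closed-form a<B = begin
      total                       ≈⟨ total-split ⟩
      bulk + last                 ≈⟨ +-cong (bulk-in-J a<B) (*-congʳ (*-congʳ (reflexive (δ-above a<B)))) ⟩
      _                           ≈⟨ closed-plus-residuals (g B) g′ (J k) (J (k ℤ.- N)) (J (k ℤ.- Δ)) (J (k ℤ.- Δ ℤ.- N))
                                             (point a k) (point (a ℤ.+ N) k) (point (M ℤ.+ N) k) (point B k)
                                             (point (B ℤ.+ N) k) (point E k) (point (a ℤ.+ Δ) k) ⟩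
      closed (g B) g′ (point (a ℤ.+ Δ) k) (point E k)
        + ((u * u) * (J k + - J (k ℤ.- N) + - (point a k + - point (M ℤ.+ N) k))
        + ((v * g B) * (u * u)) * (J (k ℤ.- Δ) + - J (k ℤ.- Δ ℤ.- N) + - (point (a ℤ.+ Δ) k + - point (B ℤ.+ N) k)))
                                  ≈⟨ +-congˡ (+-cong (*-congˡ (telescope-at-k a<B)) (*-congˡ (telescope-at-k-Δ a<B))) ⟩
      closed (g B) g′ (point (a ℤ.+ Δ) k) (point E k) + (u * u * 0# + v * g B * (u * u) * 0#)
                                  ≈⟨ trans (+-congˡ (trans (+-cong (zeroʳ _) (zeroʳ _)) (+-identityʳ 0#))) (+-identityʳ _) ⟩
      closed (g B) g′ (point (a ℤ.+ Δ) k) (point E k) ∎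
      where
      closed-plus-residuals : ∀ G G′ Jk JkN Js JsN pa paN pMN pB pBN pE pΔ →
        1# * (u * (u * Jk + - pa)) + (- v * (u * (u * JkN + - paN)) + (- u * (u * (u * JkN + - pMN))
          + ((v * G) * (u * (u * Js + - pB)) + - (v * G) * (u * (u * JsN + - pBN)))))
        + (u * (v * G)) * profile (v * G′) pB pBN pE pa paN
        ≈ u * (u * (v * G) * (pΔ + - pE) + v * ((v * G) * G′ + - 1#) * (pa + - paN))
          + ((u * u) * (Jk + - JkN + - (pa + - pMN)) + ((v * G) * (u * u)) * (Js + - JsN + - (pΔ + - pBN)))
      closed-plus-residuals = solve 14 (λ v G G′ Jk JkN Js JsN pa paN pMN pB pBN pE pΔ →
        let u = con (+ 1) :+ :- v in
        con (+ 1) :* (u :* (u :* Jk :+ :- pa)) :+ (:- v :* (u :* (u :* JkN :+ :- paN)) :+ (:- u :* (u :* (u :* JkN :+ :- pMN))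
          :+ ((v :* G) :* (u :* (u :* Js :+ :- pB)) :+ :- (v :* G) :* (u :* (u :* JsN :+ :- pBN)))))
        :+ (u :* (v :* G)) :* (pB :+ :- (v :* pBN) :+ :- (u :* pE :+ :- ((v :* G′) :* pa) :+ (v :* G′) :* paN))
        := u :* (u :* (v :* G) :* (pΔ :+ :- pE) :+ v :* ((v :* G) :* G′ :+ :- con (+ 1)) :* (pa :+ :- paN))
          :+ ((u :* u) :* (Jk :+ :- JkN :+ :- (pa :+ :- pMN)) :+ ((v :* G) :* (u :* u)) :* (Js :+ :- JsN :+ :- (pΔ :+ :- pBN)))) refl v

    bulk-vanishes : B ℤ.≤ a → bulk ≈ 0#
    bulk-vanishes B≤a = trans
      (+-cong (*-congˡ (K-vanishes B≤a _)) (+-cong (*-congˡ (K-vanishes B≤a _)) (+-cong (*-congˡ (K-vanishes B≤a _))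
              (+-cong (*-congˡ (K-vanishes B≤a _)) (*-congˡ (K-vanishes B≤a _))))))
      (solve 4 (λ x y z w → con (+ 1) :* con (+ 0) :+ (x :* con (+ 0) :+ (y :* con (+ 0) :+ (z :* con (+ 0) :+ w :* con (+ 0))))
                := con (+ 0)) refl (- v) (- u) gB (- gB))

    g≈-1 : ∀ {x} → + n ∣ x → g x ≈ - 1#
    g≈-1 {x} n∣x = trans (g-resp-∣ x (+ 0) (∣-resp-≡ n∣x (P.sym (ℤP.+-identityʳ x)))) g-zero

    vanishes-below-multiple : a ℤ.< B → + n ∣ B → total ≈ 0#
    vanishes-below-multiple a<B n∣B = begin
      total                                                ≈⟨ closed-form a<B ⟩
      closed (g B) g′ (point (a ℤ.+ Δ) k) (point E k)      ≈⟨ closed-cong (g≈-1 n∣B) (g≈-1 (∣m∣n⇒∣m-n n∣a n∣B))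
                                                                (reflexive (P.cong (λ d → point (a ℤ.+ d) k) (Δ-when-n∣B n∣B)))
                                                                (reflexive (P.cong (λ e → point e k) (E-when-n∣B n∣B))) ⟩
      closed (- 1#) (- 1#) (point (a ℤ.+ N) k) (point a k) ≈⟨ solve 3 (λ v p q → let u = con (+ 1) :+ :- v in
          u :* (u :* (v :* :- con (+ 1)) :* (p :+ :- q) :+ v :* ((v :* :- con (+ 1)) :* :- con (+ 1) :+ :- con (+ 1)) :* (q :+ :- p))
          := con (+ 0)) refl v (point (a ℤ.+ N) k) (point a k) ⟩
      0#                                                   ∎

    vanishes-below-nonmultiple : a ℤ.< B → ¬ (+ n ∣ B) → total ≈ 0#
    vanishes-below-nonmultiple a<B n∤B = begin
      total                                                ≈⟨ closed-form a<B ⟩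
      closed (g B) g′ (point (a ℤ.+ Δ) k) (point E k)      ≈⟨ *-congˡ (+-cong (*-congˡ E-cancels) (*-congʳ (*-congˡ gBg′-cancels))) ⟩
      u * (u * gB * 0# + v * 0# * (point a k + - point (a ℤ.+ N) k))
                                                           ≈⟨ solve 4 (λ u G v p → u :* (u :* G :* con (+ 0) :+ (v :* con (+ 0)) :* p)
                                                                := con (+ 0)) refl u gB v _ ⟩
      0#                                                   ∎
      where
      E-cancels : point (a ℤ.+ Δ) k + - point E k ≈ 0#
      E-cancels = trans (+-congˡ (-‿cong (reflexive (P.cong (λ e → point e k) (E-when-n∤B n∤B))))) (-‿inverseʳ _)
      gBg′-cancels : gB * g′ + - 1# ≈ 0#
      gBg′-cancels = trans (+-congʳ (begin
        v * g B * g (a ℤ.- B)          ≈⟨ *-assoc v (g B) _ ⟩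
        v * (g B * g (a ℤ.- B))        ≈⟨ *-congˡ (*-congˡ (g-resp-∣ (a ℤ.- B) (+ n ℤ.- B) (∣-resp-≡ (∣m∣n⇒∣m-n n∣a ∣-refl) (lemma a B N)))) ⟩
        v * (g B * g (+ n ℤ.- B))      ≈⟨ g-reflection B (n∤B ∘ ∣ᵤ⇒∣) ⟩
        1#                             ∎)) (-‿inverseʳ 1#)
        where
        lemma : ∀ a B N → a ℤ.- N ≡ a ℤ.- B ℤ.- (N ℤ.- B)
        lemma = solve-∀

    vanishes-at : a ≡ B → total ≈ 0#
    vanishes-at a≡B = begin
      total                                         ≈⟨ total-split ⟩
      bulk + last                                   ≈⟨ +-cong (bulk-vanishes (ℤP.≤-reflexive (P.sym a≡B)))
                                                        (*-cong (*-congʳ (reflexive (P.subst (λ x → δ x B ≡ - v) (P.sym a≡B) (δ-at B))))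
                                                                (profile-cong (*-congˡ (g≈-1 (∣m∣n⇒∣m-n n∣a n∣B)))
                                                                   (reflexive B≡a) (reflexive B+N≡a+N) (reflexive E≡a) refl refl)) ⟩
      0# + (- v * gB) * profile (v * - 1#) (point a k) (point (a ℤ.+ N) k) (point a k) (point a k) (point (a ℤ.+ N) k)
                                                    ≈⟨ solve 4 (λ v G p q → let u = con (+ 1) :+ :- v in
          con (+ 0) :+ (:- v :* G) :* (p :+ :- (v :* q) :+ :- (u :* p :+ :- ((v :* :- con (+ 1)) :* p) :+ (v :* :- con (+ 1)) :* q))
          := con (+ 0)) refl v gB (point a k) (point (a ℤ.+ N) k) ⟩
      0#                                            ∎
      where
      n∣B : + n ∣ B
      n∣B = P.subst (+ n ∣_) a≡B n∣a
      B≡a : point B k ≡ point a k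
      B≡a = P.cong (λ x → point x k) (P.sym a≡B)
      B+N≡a+N : point (B ℤ.+ N) k ≡ point (a ℤ.+ N) k
      B+N≡a+N = P.cong (λ x → point (x ℤ.+ N) k) (P.sym a≡B)
      E≡a : point E k ≡ point a k
      E≡a = P.cong (λ x → point x k) (E-when-n∣B n∣B)

    vanishes-above : B ℤ.< a → total ≈ 0#
    vanishes-above B<a = begin
      total               ≈⟨ total-split ⟩
      bulk + last         ≈⟨ +-cong (bulk-vanishes (ℤP.<⇒≤ B<a)) (trans (*-congʳ (trans (*-congʳ (reflexive (δ-below B<a))) (zeroˡ gB))) (zeroˡ _)) ⟩
      0# + 0#             ≈⟨ +-identityʳ 0# ⟩
      0#                  ∎

    total-vanishes : total ≈ 0#
    total-vanishes with ℤP.<-cmp a B | + n ∣? B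
    ... | tri< a<B _ _ | yes n∣B = vanishes-below-multiple a<B n∣B
    ... | tri< a<B _ _ | no n∤B  = vanishes-below-nonmultiple a<B n∤B
    ... | tri≈ _ a≡B _ | _       = vanishes-at a≡B
    ... | tri> _ _ B<a | _       = vanishes-above B<a

module Vanishing {c ℓ : Level} (R : CommutativeRing c ℓ) (n : ℕ) .{{_ : NonZero n}}
  (v : CommutativeRing.Carrier R) (G : GaussSums R n v) where
  open CommutativeRing R
  open import Relation.Binary.Reasoning.Setoid setoid
  open GaussSums G
  open Sums R
  open ChintaGunnells R
  open Action n v g
  open LineCoefficients R n v g
  open PointProfile R n v G

  ∑-point-profile : ∀ a → + 1 ℤ.≤ a → + n ∣ a → ∀ k B →
    ∑ (range1 B) (λ c → (δ a c * hB B c) * Ψ (B ℤ.- + 1 ℤ.+ a) (point k) c) ≈ 0#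
  ∑-point-profile a 1≤a n∣a k (+ zero)  = refl
  ∑-point-profile a 1≤a n∣a k (+ suc m) = Window.total-vanishes a 1≤a n∣a m k
  ∑-point-profile a 1≤a n∣a k -[1+ _ ] = refl

  𝒟-fAΓ-vanishes : ∀ {r} (i : Fin r) (a : ℕ) (λ₂ λ₃ Γ : ℤ) → 1 ℕ.≤ a → n ℕd.∣ a →
    IsZeroF (𝒟 i (fAΓ i (+ a) λ₂ λ₃ Γ))
  𝒟-fAΓ-vanishes {r} i a λ₂ λ₃ Γ 1≤a n∣a ν = begin
    coeff (num (𝒟 i (fAΓ i (+ a) λ₂ λ₃ Γ))) ν   ≈⟨ coeff-𝒟-line i λ₂ λ₃ Γ (+ a) ν (range1 B) W ⟩
    ∑ (range1 B) (λ c → W c * Ψ s′ β c)           ≡⟨ P.cong (λ x → ∑ (range1 B) (λ c → W c * Ψ x β c)) (centre≡ λ₂ λ₃ Γ (+ a)) ⟩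
    ∑ (range1 B) (λ c → W c * Ψ s β c)            ≈⟨ by-position (≡-dec ℤ._≟_ (L k₀) ν) ⟩
    0#                                            ∎
    where
    B s s′ k₀ : ℤ
    B  = Γ ℤ.+ λ₂ ℤ.- λ₃ ℤ.+ + 1
    s  = B ℤ.- + 1 ℤ.+ + a
    s′ = centre i λ₂ λ₃ Γ (+ a) ν
    k₀ = lookup ν (posL i) ℤ.- (λ₃ ℤ.- Γ)
    W β : ℤ → Carrier
    W c = δ (+ a) c * hB B c
    β   = onLine i λ₂ λ₃ Γ (+ a) ν
    L : ℤ → Vec ℤ (suc r)
    L = line i λ₂ λ₃ Γ (+ a) ν
    centre≡ : ∀ λ₂ λ₃ Γ a → Γ ℤ.+ λ₂ ℤ.- λ₃ ℤ.+ a ≡ Γ ℤ.+ λ₂ ℤ.- λ₃ ℤ.+ + 1 ℤ.- + 1 ℤ.+ a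
    centre≡ = solve-∀
    on-line⇒k₀ : ∀ e → L e ≡ ν → e ≡ k₀
    on-line⇒k₀ e Le≡ν = P.trans (lemma λ₃ Γ e)
      (P.cong (ℤ._- (λ₃ ℤ.- Γ)) (P.trans (P.sym (PairExponents.lookup-mono2-posL i _ _)) (P.cong (λ u → lookup u (posL i)) Le≡ν)))
      where
      lemma : ∀ λ₃ Γ e → e ≡ λ₃ ℤ.+ e ℤ.- Γ ℤ.- (λ₃ ℤ.- Γ)
      lemma = solve-∀
    by-position : Dec (L k₀ ≡ ν) → ∑ (range1 B) (λ c → W c * Ψ s β c) ≈ 0#
    by-position (yes Lk₀≡ν) = trans (∑-cong (range1 B) (λ c → *-congˡ (Ψ-cong s β≡point c)))
                                   (∑-point-profile (+ a) (ℤ.+≤+ 1≤a) (∣ᵤ⇒∣ n∣a) k₀ B)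
      where
      β≡point : ∀ e → β e ≡ point k₀ e
      β≡point e = 𝟙-⇔ (on-line⇒k₀ e) (λ e≡k₀ → P.subst (λ x → L x ≡ ν) (P.sym e≡k₀) Lk₀≡ν) (≡-dec ℤ._≟_ (L e) ν) (e ℤ.≟ k₀)
    by-position (no Lk₀≢ν) = ∑-zero (range1 B) (λ c → trans (*-congˡ (Ψ-zero s β≡0 c)) (zeroʳ _))
      where
      β≡0 : ∀ e → β e ≡ 0#
      β≡0 e = 𝟙-no (λ Le≡ν → Lk₀≢ν (P.subst (λ x → L x ≡ ν) (on-line⇒k₀ e Le≡ν) Le≡ν)) (≡-dec ℤ._≟_ (L e) ν)

lemma8p5 : {c ℓ : Level} (R : CommutativeRing c ℓ) →
    let open CommutativeRing R in
    (n : ℕ) .{{_ : NonZero n}} (v : Carrier) (g : ℤ → Carrier) →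
    (∀ j → g (j ℤ.+ + n) ≈ g j) →
    g (+ 0) ≈ - 1# →
    (∀ j → ¬ ((+ n) ℤd.∣ j) → v * (g j * g (+ n ℤ.- j)) ≈ 1#) →
    (k : ℕ) →
    let r = suc (suc k) in
    (lam : ℕ → ℤ) →
    (∀ j → 2 ℕ.≤ j → j ℕ.≤ r → lam (suc j) ℤ.≤ lam j) →
    (Γ : ℕ → ℤ) →
    Γ (suc r) ≡ + 0 →
    (∀ j → 3 ℕ.≤ j → j ℕ.≤ r →
      (Γ (suc j) ℤ.≤ Γ j) × (Γ j ℤ.≤ Γ (suc j) ℤ.+ lam j ℤ.- lam (suc j) ℤ.+ + 1)) →
    (3 ℕ.≤ r → Γ r ≢ + 0) →
    (a : ℕ) → 1 ℕ.≤ a → n ℕd.∣ a →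
    let open ChintaGunnells R in
    let open Action n v g in
    IsZeroF (𝒟 (inject₁ (fromℕ k)) (fAΓ (inject₁ (fromℕ k)) (+ a) (lam 2) (lam 3) (Γ 3)))
lemma8p5 R n v g g-periodic g-zero g-reflection k lam _ Γ _ _ _ a 1≤a n∣a =
  Vanishing.𝒟-fAΓ-vanishes R n v gaussSums (inject₁ (fromℕ k)) a (lam 2) (lam 3) (Γ 3) 1≤a n∣a
  where
  gaussSums : GaussSums R n v
  gaussSums = record { g = g ; g-periodic = g-periodic ; g-zero = g-zero ; g-reflection = g-reflection }
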